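{- Let $s$ be a positive integer, $Q=q^s$, and let $\rho=(\rho_1,\dots,\rho_m)$, $m\ge1$, be a sequence of integers between $1$ and $s-1$. For a strictly increasing sequence $\gamma=(\gamma_1,\dots,\gamma_m)$ of positive integers define $\mathbf d(\rho,\gamma)=(d_1,\dots,d_m)$ by $d_j=0$ if $j>1$, $\rho_{j-1}\ge\rho_j$ and $\gamma_j=\gamma_{j-1}+1$, and $d_j=1$ otherwise. Then $$\sum_{\lambda:\ \mathrm{rem}_s(\lambda)=\rho}R^{r_s(\lambda)}C^{c_s(\lambda)}q^{|\lambda|}=q^{|\rho|}\sum_{1\le\gamma_1<\dots<\gamma_m}Q^{\sum_{j=1}^m d_j(\gamma_j-1)}\left(R^{\gamma_m-m}+\sum_{k\ge1}\frac{CQ^k}{(CQ;Q)_k}R^{\max(\gamma_m-m,\,k-m)}\right).$$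
   Context: A partition $\lambda$ has size $|\lambda|=\sum\lambda_i$ and is identified with its Ferrers diagram. For a cell $z$, $\mathrm{leg}(z)$ is the number of cells strictly below $z$ in its column and $\mathrm{arm}(z)$ the number of cells strictly to its right in its row. $r_s(\lambda)$ is the number of parts divisible by $s$; $c_s(\lambda)$ is the number of cells $z$ with $\mathrm{leg}(z)=0$ and $s\mid\mathrm{arm}(z)+1$. $\mathrm{rem}_s(\lambda)$ is the sequence of non-zero remainders of $\lambda_1,\lambda_2,\dots$ modulo $s$, in order; $|\rho|=\sum\rho_j$. $(a;Q)_k=\prod_{i=0}^{k-1}(1-aQ^i)$. Identities are of formal power series in $q$ with coefficients polynomials in $R,C$. -}

module Defs where

open import Data.Nat using (ℕ; zero; suc; _+_; _*_; _∸_; _⊔_; _⊓_; _≡ᵇ_; _≤ᵇ_; NonZero)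
open import Data.Nat.DivMod using (_%_)
open import Data.Bool using (Bool; true; false; if_then_else_; _∧_)
open import Data.Nat.ListAction using (sum)
open import Data.List using (List; []; _∷_; map; length; upTo; concatMap; foldr; filter)
open import Data.List.Properties using (≡-dec)
open import Data.Nat.Properties using (_≟_)
open import Relation.Nullary using (does)

-- range lo hi = [lo, lo+1, …, hi]  (empty if hi < lo)
range : ℕ → ℕ → List ℕ
range lo hi = map (lo +_) (upTo (suc hi ∸ lo))

Σ[∈] : {A : Set} → List A → (A → ℕ) → ℕ
Σ[∈] xs f = sum (map f xs)

count : {A : Set} → (A → Bool) → List A → ℕ
count p [] = 0
count p (x ∷ xs) = (if p x then 1 else 0) + count p xs

listEqᵇ : List ℕ → List ℕ → Bool
listEqᵇ xs ys = does (≡-dec _≟_ xs ys)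

-- Formal power series in q whose coefficients are polynomials in R, C
-- (all coefficients occurring here are natural numbers).
-- F n a b  =  coefficient of  q^n R^a C^b  in F.

Series : Set
Series = ℕ → ℕ → ℕ → ℕ

_⊕_ : Series → Series → Series
(F ⊕ G) n a b = F n a b + G n a b

_⊗_ : Series → Series → Series
(F ⊗ G) n a b =
  Σ[∈] (range 0 n) λ n₁ → Σ[∈] (range 0 a) λ a₁ → Σ[∈] (range 0 b) λ b₁ →
    F n₁ a₁ b₁ * G (n ∸ n₁) (a ∸ a₁) (b ∸ b₁)

mono : ℕ → ℕ → ℕ → Series
mono e r c n a b = if (n ≡ᵇ e) ∧ (a ≡ᵇ r) ∧ (b ≡ᵇ c) then 1 else 0

one : Series
one = mono 0 0 0

-- 1 / (1 - C Q^i) = Σ_{j ≥ 0} C^j Q^{i j},  with Q = q^s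
geomCQ : ℕ → ℕ → Series
geomCQ s i n a b = if (a ≡ᵇ 0) ∧ (n ≡ᵇ s * i * b) then 1 else 0

-- 1 / (CQ;Q)_k = Π_{i=1}^{k} 1/(1 - C Q^i)
invPoch : ℕ → ℕ → Series
invPoch s k = foldr (λ i F → geomCQ s i ⊗ F) one (range 1 k)

-- Partitions (as weakly decreasing lists of positive parts)

-- parts fuel n mx : all partitions of n with all parts ≤ mx
parts : ℕ → ℕ → ℕ → List (List ℕ)
parts _ zero _ = [] ∷ []
parts zero (suc n) _ = []
parts (suc f) (suc n) mx =
  concatMap (λ p → map (p ∷_) (parts f (suc n ∸ p) p)) (range 1 (suc n ⊓ mx))

partitionsOf : ℕ → List (List ℕ)
partitionsOf n = parts n n n

incSeqs : ℕ → ℕ → ℕ → List (List ℕ)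
incSeqs zero lo hi = [] ∷ []
incSeqs (suc m) lo hi = concatMap (λ x → map (x ∷_) (incSeqs m (suc x) hi)) (range lo hi)

dTail : ℕ → ℕ → List ℕ → List ℕ → List ℕ
dTail ρp γp (r ∷ rs) (g ∷ gs) =
  (if (r ≤ᵇ ρp) ∧ (g ≡ᵇ suc γp) then 0 else 1) ∷ dTail r g rs gs
dTail _ _ _ _ = []

dVec : List ℕ → List ℕ → List ℕ
dVec (r ∷ rs) (g ∷ gs) = 1 ∷ dTail r g rs gs
dVec _ _ = []

dExp : List ℕ → List ℕ → ℕ
dExp ρ γ = sum (Data.List.zipWith (λ d g → d * (g ∸ 1)) (dVec ρ γ) γ)

-- last entry (γ_m); 0 on the empty list (never used: m ≥ 1)
lastOr0 : List ℕ → ℕ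
lastOr0 [] = 0
lastOr0 (x ∷ []) = x
lastOr0 (x ∷ y ∷ ys) = lastOr0 (y ∷ ys)

module _ (s : ℕ) .{{_ : NonZero s}} where

  -- r_s(λ): number of parts divisible by s
  rS : List ℕ → ℕ
  rS λ′ = count (λ p → p % s ≡ᵇ 0) λ′

  -- rem_s(λ): non-zero remainders of the parts mod s, in order
  remS : List ℕ → List ℕ
  remS [] = []
  remS (p ∷ ps) = if p % s ≡ᵇ 0 then remS ps else (p % s) ∷ remS ps

  -- c_s(λ): number of cells z with leg(z) = 0 and s ∣ arm(z) + 1.
  -- Cell in column j (1-indexed) of a row of length ℓ, with rows below `rest`:
  --   arm = ℓ - j,  leg = #{ rows below with length ≥ j }.
  cS : List ℕ → ℕ
  cS [] = 0
  cS (ℓ ∷ rest) =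
    count (λ j → (length (filter (λ r → j Data.Nat.≤? r) rest) ≡ᵇ 0)
                 ∧ ((ℓ ∸ j + 1) % s ≡ᵇ 0))
          (range 1 ℓ)
    + cS rest

  -- Left-hand side:  Σ_{λ : rem_s(λ) = ρ} R^{r_s(λ)} C^{c_s(λ)} q^{|λ|}
  -- (coefficient of q^n only involves the finitely many partitions of n)

  LHS : List ℕ → Series
  LHS ρ n a b =
    Σ[∈] (filter (λ λ′ → listEqᵇ (remS λ′) ρ Data.Bool.≟ true) (partitionsOf n))
         (λ λ′ → mono n (rS λ′) (cS λ′) n a b)

  -- The term of index k has q-order ≥ s k ≥ k, so the
  -- coefficient of q^n only receives contributions from k ≤ n.
  innerTerm : ℕ → ℕ → ℕ → Series
  innerTerm m g k = mono (s * k) 0 1 ⊗ (invPoch s k ⊗ mono 0 ((g ∸ m) ⊔ (k ∸ m)) 0)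

  inner : ℕ → ℕ → Series
  inner m g = mono 0 (g ∸ m) 0 ⊕ (λ n a b → Σ[∈] (range 1 n) (λ k → innerTerm m g k n a b))

  γTerm : List ℕ → List ℕ → Series
  γTerm ρ γ = mono (s * dExp ρ γ) 0 0 ⊗ inner (length ρ) (lastOr0 γ)

  -- A term with Σ d_j(γ_j-1) = e has q-order
  -- ≥ e, and e ≤ n forces γ_m ≤ n + m, so the coefficient of q^n only
  -- receives contributions from γ with entries in [1, n+m].
  γSum : List ℕ → Series
  γSum ρ n a b = Σ[∈] (incSeqs (length ρ) 1 (n + length ρ)) (λ γ → γTerm ρ γ n a b)

  RHS : List ℕ → Series
  RHS ρ = mono (sum ρ) 0 0 ⊗ γSum ρ

-- Write a partition row by row: the residue rᵢ = λᵢ mod s and the excess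
-- eᵢ = ⌊(λᵢ − λᵢ₊₁)/s⌋ determine λ, since λᵢ − λᵢ₊₁ = s eᵢ + ((rᵢ − rᵢ₊₁) mod s).
-- Then r_s(λ) is the number of zero residues, c_s(λ) = Σ eᵢ, and
-- |λ| = Σ rᵢ + s Σ i eᵢ + s Σ_{rᵢ < rᵢ₊₁} i.  The nonzero residues form ρ, at
-- positions γ, and the ascent term is exactly Σ dⱼ (γⱼ − 1).  The excess word
-- is either zero, so that λ has γ_m rows, or has its last positive letter at
-- some k, which accounts for C Q^k/(CQ;Q)_k and max(γ_m, k) rows.  Coefficient
-- by coefficient both sides are therefore finite sums over the same objects.
module Submission where

open import Defs
open import Data.Bool using (Bool; true; false; if_then_else_; _∧_; T)
import Data.Bool as Bool
open import Data.Bool.Properties using (T-∧; ∧-identityʳ; ∧-zeroʳ)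
open import Data.List using (List; []; _∷_; _++_; map; concatMap; filter; foldr; applyUpTo; length; drop; replicate; zipWith)
open import Data.List.Membership.Propositional using (_∈_; _∉_; find)
open import Data.List.Membership.Propositional.Properties using (∈-map⁻; ∈-concatMap⁻)
open import Data.List.Properties using (map-++; map-∘; map-cong; map-cong-local; map-applyUpTo; length-map; length-replicate; filter-some; filter-none; ≡-dec; ∷-injective)
open import Data.List.Relation.Unary.All as All using (All; []; _∷_)
open import Data.List.Relation.Unary.Any using (here; there)
open import Data.Nat using (ℕ; zero; suc; _+_; _*_; _∸_; _≤_; _<_; _⊔_; _⊓_; z≤n; s≤s; s≤s⁻¹; z<s; _≡ᵇ_; _≤ᵇ_; _<ᵇ_; NonZero; >-nonZero⁻¹)
open import Data.Nat.DivMod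
open import Data.Nat.Divisibility using (divides-refl)
open import Data.Nat.ListAction using (sum)
open import Data.Nat.ListAction.Properties using (sum-++)
open import Data.Nat.Properties
open import Algebra.Properties.CommutativeSemigroup +-commutativeSemigroup using (interchange)
open import Data.Nat.Tactic.RingSolver using (solve-∀)
open import Data.Product using (Σ; _×_; _,_; proj₁; proj₂)
import Data.Product.Properties as Product
open import Function using (id)
open import Function.Bundles using (Equivalence)
open import Level using (Level)
open import Relation.Binary.Definitions using (DecidableEquality)
open import Relation.Binary.PropositionalEquality
open import Relation.Nullary using (Dec; yes; no; does; ¬_; contradiction)
open import Relation.Nullary.Decidable using (dec-true; dec-false; does-≡; map′; _×-dec_)
open import Relation.Unary using (Pred; Decidable)
open ≡-Reasoning

private
  variable
    A B : Set

𝟙 : Bool → ℕ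
𝟙 b = if b then 1 else 0

𝟙-∧ : ∀ x y → 𝟙 (x ∧ y) ≡ 𝟙 x * 𝟙 y
𝟙-∧ true y = sym (+-identityʳ (𝟙 y))
𝟙-∧ false y = refl

𝟙-yes : ∀ {P : Set} (p? : Dec P) → P → 𝟙 (does p?) ≡ 1
𝟙-yes p? p = cong 𝟙 (dec-true p? p)

𝟙-no : ∀ {P : Set} (p? : Dec P) → ¬ P → 𝟙 (does p?) ≡ 0
𝟙-no p? ¬p = cong 𝟙 (dec-false p? ¬p)

does-cong : ∀ {P Q : Set} (p? : Dec P) (q? : Dec Q) → (P → Q) → (Q → P) → does p? ≡ does q?
does-cong p? q? P→Q Q→P = does-≡ (map′ P→Q Q→P p?) q?

𝟙-cong : ∀ {P Q : Set} (p? : Dec P) (q? : Dec Q) → (P → Q) → (Q → P) → 𝟙 (does p?) ≡ 𝟙 (does q?)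
𝟙-cong p? q? P→Q Q→P = cong 𝟙 (does-cong p? q? P→Q Q→P)

𝟙≢0⇒T : ∀ {b} → 𝟙 b ≢ 0 → T b
𝟙≢0⇒T {true} _ = _
𝟙≢0⇒T {false} h = h refl

does≡true⇒ : ∀ {P : Set} (p? : Dec P) → does p? ≡ true → P
does≡true⇒ (yes p) _ = p

𝟙≢0⇒ : ∀ {P : Set} (p? : Dec P) → 𝟙 (does p?) ≢ 0 → P
𝟙≢0⇒ (yes p) _ = p
𝟙≢0⇒ (no _) h = contradiction refl h

*≢0⇒≢0 : ∀ {m n} → m * n ≢ 0 → m ≢ 0 × n ≢ 0
*≢0⇒≢0 {m} {n} h = (λ { refl → h refl }) , (λ { refl → h (*-zeroʳ m) })

mono≢0 : ∀ {e r c n a b} → mono e r c n a b ≢ 0 → n ≡ e × a ≡ r × b ≡ c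
mono≢0 {e} {r} {c} {n} {a} {b} h with Equivalence.to T-∧ (𝟙≢0⇒T h)
... | n≡e , rest with Equivalence.to T-∧ rest
... | a≡r , b≡c = ≡ᵇ⇒≡ n e n≡e , ≡ᵇ⇒≡ a r a≡r , ≡ᵇ⇒≡ b c b≡c

mono-diag : ∀ n a b → mono n a b n a b ≡ 1
mono-diag n a b rewrite dec-true (n ≟ n) refl | dec-true (a ≟ a) refl | dec-true (b ≟ b) refl = refl

Σ-cong : ∀ (xs : List A) {f g : A → ℕ} → (∀ x → f x ≡ g x) → Σ[∈] xs f ≡ Σ[∈] xs g
Σ-cong xs f≗g = cong sum (map-cong f≗g xs)

Σ-cong-∈ : ∀ (xs : List A) {f g : A → ℕ} → (∀ {x} → x ∈ xs → f x ≡ g x) → Σ[∈] xs f ≡ Σ[∈] xs g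
Σ-cong-∈ xs f≗g = cong sum (map-cong-local (All.tabulate f≗g))

Σ-++ : ∀ (xs ys : List A) f → Σ[∈] (xs ++ ys) f ≡ Σ[∈] xs f + Σ[∈] ys f
Σ-++ xs ys f = trans (cong sum (map-++ f xs ys)) (sum-++ (map f xs) (map f ys))

Σ-map : ∀ (h : A → B) xs f → Σ[∈] (map h xs) f ≡ Σ[∈] xs (λ x → f (h x))
Σ-map h xs f = cong sum (sym (map-∘ xs))

Σ-concatMap : ∀ (h : A → List B) xs f → Σ[∈] (concatMap h xs) f ≡ Σ[∈] xs (λ x → Σ[∈] (h x) f)
Σ-concatMap h [] f = refl
Σ-concatMap h (x ∷ xs) f =
  trans (Σ-++ (h x) (concatMap h xs) f) (cong (Σ[∈] (h x) f +_) (Σ-concatMap h xs f))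

Σ-distrib-+ : ∀ (xs : List A) f g → Σ[∈] xs (λ x → f x + g x) ≡ Σ[∈] xs f + Σ[∈] xs g
Σ-distrib-+ [] f g = refl
Σ-distrib-+ (x ∷ xs) f g =
  trans (cong (f x + g x +_) (Σ-distrib-+ xs f g)) (interchange (f x) (g x) _ _)

*-distribˡ-Σ : ∀ c (xs : List A) f → c * Σ[∈] xs f ≡ Σ[∈] xs (λ x → c * f x)
*-distribˡ-Σ c [] f = *-zeroʳ c
*-distribˡ-Σ c (x ∷ xs) f = trans (*-distribˡ-+ c (f x) _) (cong (c * f x +_) (*-distribˡ-Σ c xs f))

Σ-zero-∈ : ∀ (xs : List A) f → (∀ {x} → x ∈ xs → f x ≡ 0) → Σ[∈] xs f ≡ 0
Σ-zero-∈ xs f h = trans (Σ-cong-∈ xs h) (Σ-const-0 xs)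
  where
  Σ-const-0 : ∀ (xs : List A) → Σ[∈] xs (λ _ → 0) ≡ 0
  Σ-const-0 [] = refl
  Σ-const-0 (_ ∷ xs) = Σ-const-0 xs

Σ-comm : ∀ (xs : List A) (ys : List B) (f : A → B → ℕ) →
  Σ[∈] xs (λ x → Σ[∈] ys (f x)) ≡ Σ[∈] ys (λ y → Σ[∈] xs (λ x → f x y))
Σ-comm [] ys f = sym (Σ-zero-∈ ys (λ _ → 0) (λ _ → refl))
Σ-comm (x ∷ xs) ys f = trans (cong (Σ[∈] ys (f x) +_) (Σ-comm xs ys f)) (sym (Σ-distrib-+ ys (f x) (λ y → Σ[∈] xs (λ x′ → f x′ y))))

Σ-filter : ∀ {p : Level} {P : Pred A p} (P? : Decidable P) xs f →
  Σ[∈] (filter P? xs) f ≡ Σ[∈] xs (λ x → 𝟙 (does (P? x)) * f x)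
Σ-filter P? [] f = refl
Σ-filter P? (x ∷ xs) f with does (P? x)
... | true = cong₂ _+_ (sym (+-identityʳ (f x))) (Σ-filter P? xs f)
... | false = Σ-filter P? xs f

module _ {A : Set} (_≟ᴬ_ : DecidableEquality A) where

  mult : A → List A → ℕ
  mult y xs = Σ[∈] xs (λ x → 𝟙 (does (x ≟ᴬ y)))

  Σ-point : ∀ xs y (h : A → ℕ) → Σ[∈] xs (λ x → 𝟙 (does (x ≟ᴬ y)) * h x) ≡ mult y xs * h y
  Σ-point xs y h = begin
    Σ[∈] xs (λ x → 𝟙 (does (x ≟ᴬ y)) * h x) ≡⟨ Σ-cong xs at-y ⟩
    Σ[∈] xs (λ x → h y * 𝟙 (does (x ≟ᴬ y))) ≡⟨ *-distribˡ-Σ (h y) xs _ ⟨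
    h y * mult y xs                          ≡⟨ *-comm (h y) _ ⟩
    mult y xs * h y                          ∎
    where
    at-y : ∀ x → 𝟙 (does (x ≟ᴬ y)) * h x ≡ h y * 𝟙 (does (x ≟ᴬ y))
    at-y x with x ≟ᴬ y
    ... | yes refl = *-comm 1 (h x)
    ... | no _ = sym (*-zeroʳ (h y))

  mult-∉ : ∀ {y xs} → y ∉ xs → mult y xs ≡ 0
  mult-∉ {y} {xs} y∉ = Σ-zero-∈ xs _ (λ {x} x∈ → 𝟙-no (x ≟ᴬ y) (λ { refl → y∉ x∈ }))

mult-map : ∀ {A B : Set} (_≟ᴬ_ : DecidableEquality A) (_≟ᴮ_ : DecidableEquality B) (h : A → B) →
           (∀ {x y} → h x ≡ h y → x ≡ y) → ∀ xs y → mult _≟ᴮ_ (h y) (map h xs) ≡ mult _≟ᴬ_ y xs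
mult-map _≟ᴬ_ _≟ᴮ_ h inj xs y =
  trans (Σ-map h xs _) (Σ-cong xs (λ x → 𝟙-cong (h x ≟ᴮ h y) (x ≟ᴬ y) inj (cong h)))

module _ {A B C : Set} (_≟ᴬ_ : DecidableEquality A) (_≟ᴮ_ : DecidableEquality B) (_≟ᶜ_ : DecidableEquality C)
         (_⊕_ : A → B → C) (⊕-injective : ∀ {x x′ t t′} → x ⊕ t ≡ x′ ⊕ t′ → x ≡ x′ × t ≡ t′) where

  mult-concatMap : ∀ (F : A → List B) xs x t →
    mult _≟ᶜ_ (x ⊕ t) (concatMap (λ x → map (x ⊕_) (F x)) xs) ≡ mult _≟ᴬ_ x xs * mult _≟ᴮ_ t (F x)
  mult-concatMap F xs x t = begin
    mult _≟ᶜ_ (x ⊕ t) (concatMap block xs)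
      ≡⟨ Σ-concatMap block xs _ ⟩
    Σ[∈] xs (λ x′ → mult _≟ᶜ_ (x ⊕ t) (block x′))
      ≡⟨ Σ-cong xs block-mult ⟩
    Σ[∈] xs (λ x′ → 𝟙 (does (x′ ≟ᴬ x)) * mult _≟ᴮ_ t (F x))
      ≡⟨ Σ-point _≟ᴬ_ xs x (λ _ → mult _≟ᴮ_ t (F x)) ⟩
    mult _≟ᴬ_ x xs * mult _≟ᴮ_ t (F x) ∎
    where
    block : A → List C
    block x′ = map (x′ ⊕_) (F x′)
    block-mult : ∀ x′ → mult _≟ᶜ_ (x ⊕ t) (block x′) ≡ 𝟙 (does (x′ ≟ᴬ x)) * mult _≟ᴮ_ t (F x)
    block-mult x′ with x′ ≟ᴬ x
    ... | yes refl = trans (mult-map _≟ᴮ_ _≟ᶜ_ (x ⊕_) (λ e → proj₂ (⊕-injective e)) (F x) t) (sym (+-identityʳ _))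
    ... | no x′≢x = mult-∉ _≟ᶜ_ {x ⊕ t} {block x′} λ m → let (_ , _ , e) = ∈-map⁻ (x′ ⊕_) m in x′≢x (sym (proj₁ (⊕-injective e)))

∈-concatMap-map⁻ : ∀ {A B C : Set} (_⊕_ : A → B → C) (F : A → List B) xs {y} →
  y ∈ concatMap (λ x → map (x ⊕_) (F x)) xs → Σ A λ x → Σ B λ t → x ∈ xs × t ∈ F x × y ≡ x ⊕ t
∈-concatMap-map⁻ _⊕_ F xs y∈ with find (∈-concatMap⁻ (λ x → map (x ⊕_) (F x)) {xs = xs} y∈)
... | x , x∈ , y∈map with ∈-map⁻ (x ⊕_) y∈map
... | t , t∈ , refl = x , t , x∈ , t∈ , refl

private
  Σ-collapse : ∀ {A B : Set} (_≟ᴬ_ : DecidableEquality A) (_≟ᴮ_ : DecidableEquality B) {x} (ys : List B)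
    (f : A → B) (g : B → A) (F : A → ℕ) → (F x ≢ 0 → mult _≟ᴮ_ (f x) ys ≡ 1 × g (f x) ≡ x) →
    Σ[∈] ys (λ y → 𝟙 (does (y ≟ᴮ f x)) * (𝟙 (does (x ≟ᴬ g y)) * F x)) ≡ F x
  Σ-collapse _≟ᴬ_ _≟ᴮ_ {x} ys f g F on-support with F x ≟ 0
  ... | yes Fx≡0 = trans (Σ-zero-∈ ys _ λ {y} _ → weight-0 (𝟙 (does (y ≟ᴮ f x))) (𝟙 (does (x ≟ᴬ g y)))) (sym Fx≡0)
    where
    weight-0 : ∀ i j → i * (j * F x) ≡ 0
    weight-0 i j rewrite Fx≡0 | *-zeroʳ j = *-zeroʳ i
  ... | no Fx≢0 = let (once , gfx≡x) = on-support Fx≢0 in begin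
    Σ[∈] ys (λ y → 𝟙 (does (y ≟ᴮ f x)) * (𝟙 (does (x ≟ᴬ g y)) * F x))
      ≡⟨ Σ-point _≟ᴮ_ ys (f x) (λ y → 𝟙 (does (x ≟ᴬ g y)) * F x) ⟩
    mult _≟ᴮ_ (f x) ys * (𝟙 (does (x ≟ᴬ g (f x))) * F x)
      ≡⟨ cong₂ (λ m i → m * (i * F x)) once (𝟙-yes (x ≟ᴬ g (f x)) (sym gfx≡x)) ⟩
    1 * (1 * F x)
      ≡⟨ trans (*-identityˡ _) (*-identityˡ _) ⟩
    F x ∎

module _ {A B : Set} (_≟ᴬ_ : DecidableEquality A) (_≟ᴮ_ : DecidableEquality B) where

  -- Double counting: both sides equal Σₓ Σ_y [y = f x] [x = g y] F x.
  Σ-bijection : ∀ (xs : List A) (ys : List B) (F : A → ℕ) (G : B → ℕ) (f : A → B) (g : B → A) →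
    (∀ {x} → x ∈ xs → F x ≢ 0 → mult _≟ᴮ_ (f x) ys ≡ 1 × G (f x) ≡ F x × g (f x) ≡ x) →
    (∀ {y} → y ∈ ys → G y ≢ 0 → mult _≟ᴬ_ (g y) xs ≡ 1 × F (g y) ≡ G y × f (g y) ≡ y) →
    Σ[∈] xs F ≡ Σ[∈] ys G
  Σ-bijection xs ys F G f g f-ok g-ok = begin
    Σ[∈] xs F
      ≡⟨ Σ-cong-∈ xs (λ x∈ → sym (Σ-collapse _≟ᴬ_ _≟ᴮ_ ys f g F (λ Fx≢0 → let (m , _ , e) = f-ok x∈ Fx≢0 in m , e))) ⟩
    Σ[∈] xs (λ x → Σ[∈] ys (λ y → 𝟙 (does (y ≟ᴮ f x)) * (𝟙 (does (x ≟ᴬ g y)) * F x)))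
      ≡⟨ Σ-comm xs ys _ ⟩
    Σ[∈] ys (λ y → Σ[∈] xs (λ x → 𝟙 (does (y ≟ᴮ f x)) * (𝟙 (does (x ≟ᴬ g y)) * F x)))
      ≡⟨ Σ-cong-∈ ys (λ y∈ → Σ-cong-∈ xs (λ x∈ → swap-weights x∈ y∈)) ⟩
    Σ[∈] ys (λ y → Σ[∈] xs (λ x → 𝟙 (does (x ≟ᴬ g y)) * (𝟙 (does (y ≟ᴮ f x)) * G y)))
      ≡⟨ Σ-cong-∈ ys (λ y∈ → Σ-collapse _≟ᴮ_ _≟ᴬ_ xs g f G (λ Gy≢0 → let (m , _ , e) = g-ok y∈ Gy≢0 in m , e)) ⟩
    Σ[∈] ys G ∎
    where
    F≡G : ∀ {x} → x ∈ xs → f x ∈ ys → g (f x) ≡ x → F x ≡ G (f x)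
    F≡G {x} x∈ fx∈ gfx≡x with F x ≟ 0 | G (f x) ≟ 0
    ... | yes Fx≡0 | yes Gfx≡0 = trans Fx≡0 (sym Gfx≡0)
    ... | no Fx≢0 | _ = sym (proj₁ (proj₂ (f-ok x∈ Fx≢0)))
    ... | yes Fx≡0 | no Gfx≢0 = contradiction (trans (cong F (sym gfx≡x)) (proj₁ (proj₂ (g-ok fx∈ Gfx≢0)))) (λ e → Gfx≢0 (trans (sym e) Fx≡0))
    swap-weights : ∀ {x y} → x ∈ xs → y ∈ ys →
      𝟙 (does (y ≟ᴮ f x)) * (𝟙 (does (x ≟ᴬ g y)) * F x) ≡ 𝟙 (does (x ≟ᴬ g y)) * (𝟙 (does (y ≟ᴮ f x)) * G y)
    swap-weights {x} {y} x∈ y∈ with y ≟ᴮ f x | x ≟ᴬ g y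
    ... | yes refl | yes x≡gy = cong (λ v → 1 * (1 * v)) (F≡G x∈ y∈ (sym x≡gy))
    ... | yes _ | no _ = refl
    ... | no _ | yes _ = refl
    ... | no _ | no _ = refl

interval : ℕ → ℕ → List ℕ
interval lo zero = []
interval lo (suc c) = lo ∷ interval (suc lo) c

length-interval : ∀ lo c → length (interval lo c) ≡ c
length-interval lo zero = refl
length-interval lo (suc c) = cong suc (length-interval (suc lo) c)

range≡interval : ∀ lo hi → range lo hi ≡ interval lo (suc hi ∸ lo)
range≡interval lo hi = trans (map-applyUpTo id (lo +_) (suc hi ∸ lo)) (applyUpTo-interval lo _ (λ _ → refl))
  where
  applyUpTo-interval : ∀ {f} lo c → (∀ x → f x ≡ lo + x) → applyUpTo f c ≡ interval lo c
  applyUpTo-interval lo zero f≗ = refl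
  applyUpTo-interval lo (suc c) f≗ =
    cong₂ _∷_ (trans (f≗ 0) (+-identityʳ lo)) (applyUpTo-interval (suc lo) c (λ x → trans (f≗ (suc x)) (+-suc lo x)))

length-range : ∀ lo hi → length (range lo hi) ≡ suc hi ∸ lo
length-range lo hi = trans (cong length (range≡interval lo hi)) (length-interval lo _)

∈-interval⁻ : ∀ {x} lo c → x ∈ interval lo c → lo ≤ x × x < lo + c
∈-interval⁻ lo (suc c) (here refl) = ≤-refl , m<m+n lo z<s
∈-interval⁻ {x} lo (suc c) (there x∈) =
  let (lo<x , x<) = ∈-interval⁻ (suc lo) c x∈ in <⇒≤ lo<x , subst (x <_) (sym (+-suc lo c)) x<

∈-range⁻ : ∀ {x} lo hi → x ∈ range lo hi → lo ≤ x × x ≤ hi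
∈-range⁻ {x} lo hi x∈ with ∈-interval⁻ lo (suc hi ∸ lo) (subst (x ∈_) (range≡interval lo hi) x∈) | lo ≤? suc hi
... | lo≤x , x< | yes lo≤1+hi = lo≤x , s≤s⁻¹ (subst (x <_) (m+[n∸m]≡n lo≤1+hi) x<)
... | lo≤x , x< | no lo≰1+hi =
  contradiction (subst (x <_) (trans (cong (lo +_) (m≤n⇒m∸n≡0 (<⇒≤ (≰⇒> lo≰1+hi)))) (+-identityʳ lo)) x<) (≤⇒≯ lo≤x)

mult-interval : ∀ {y} lo c → lo ≤ y → y < lo + c → mult _≟_ y (interval lo c) ≡ 1
mult-interval {y} lo zero lo≤y y< = contradiction (subst (y <_) (+-identityʳ lo) y<) (≤⇒≯ lo≤y)
mult-interval {y} lo (suc c) lo≤y y< with lo ≟ y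
... | yes refl = cong₂ _+_ (𝟙-yes (y ≟ y) refl) (mult-∉ _≟_ (λ y∈ → <-irrefl refl (proj₁ (∈-interval⁻ (suc lo) c y∈))))
... | no lo≢y = cong₂ _+_ (𝟙-no (lo ≟ y) lo≢y) (mult-interval (suc lo) c (≤∧≢⇒< lo≤y lo≢y) (subst (y <_) (+-suc lo c) y<))

mult-range : ∀ {y} lo hi → lo ≤ y → y ≤ hi → mult _≟_ y (range lo hi) ≡ 1
mult-range {y} lo hi lo≤y y≤hi = trans (cong (mult _≟_ y) (range≡interval lo hi))
  (mult-interval lo _ lo≤y (subst (y <_) (sym (m+[n∸m]≡n (≤-trans lo≤y (m≤n⇒m≤1+n y≤hi)))) (s≤s y≤hi)))

mult-range-0 : ∀ y n → mult _≟_ y (range 0 n) ≡ 𝟙 (y ≤ᵇ n)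
mult-range-0 y n with y ≤? n
... | yes y≤n = trans (mult-range 0 n z≤n y≤n) (sym (𝟙-yes (y ≤? n) y≤n))
... | no y≰n = trans (mult-∉ _≟_ (λ y∈ → y≰n (proj₂ (∈-range⁻ 0 n y∈)))) (sym (𝟙-no (y ≤? n) y≰n))

Σ-range-point : ∀ n e (h : ℕ → ℕ) → Σ[∈] (range 0 n) (λ x → 𝟙 (x ≡ᵇ e) * h x) ≡ 𝟙 (e ≤ᵇ n) * h e
Σ-range-point n e h = trans (Σ-point _≟_ (range 0 n) e h) (cong (_* h e) (mult-range-0 e n))

Σ-range-point-∸ : ∀ n d (h : ℕ → ℕ) → Σ[∈] (range 0 n) (λ x → 𝟙 (n ∸ x ≡ᵇ d) * h x) ≡ 𝟙 (d ≤ᵇ n) * h (n ∸ d)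
Σ-range-point-∸ n d h = begin
  Σ[∈] (range 0 n) (λ x → 𝟙 (n ∸ x ≡ᵇ d) * h x)
    ≡⟨ Σ-cong-∈ (range 0 n) (λ x∈ → trans (cong (_* h _) (reflect (proj₂ (∈-range⁻ 0 n x∈)))) (*-assoc (𝟙 (d ≤ᵇ n)) _ _)) ⟩
  Σ[∈] (range 0 n) (λ x → 𝟙 (d ≤ᵇ n) * (𝟙 (x ≡ᵇ n ∸ d) * h x))
    ≡⟨ *-distribˡ-Σ (𝟙 (d ≤ᵇ n)) (range 0 n) _ ⟨
  𝟙 (d ≤ᵇ n) * Σ[∈] (range 0 n) (λ x → 𝟙 (x ≡ᵇ n ∸ d) * h x)
    ≡⟨ cong (𝟙 (d ≤ᵇ n) *_) (Σ-range-point n (n ∸ d) h) ⟩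
  𝟙 (d ≤ᵇ n) * (𝟙 (n ∸ d ≤ᵇ n) * h (n ∸ d))
    ≡⟨ cong (λ i → 𝟙 (d ≤ᵇ n) * (i * h (n ∸ d))) (𝟙-yes (n ∸ d ≤? n) (m∸n≤m n d)) ⟩
  𝟙 (d ≤ᵇ n) * (1 * h (n ∸ d))
    ≡⟨ cong (𝟙 (d ≤ᵇ n) *_) (*-identityˡ _) ⟩
  𝟙 (d ≤ᵇ n) * h (n ∸ d) ∎
  where
  reflect : ∀ {x} → x ≤ n → 𝟙 (n ∸ x ≡ᵇ d) ≡ 𝟙 (d ≤ᵇ n) * 𝟙 (x ≡ᵇ n ∸ d)
  reflect {x} x≤n = trans (𝟙-cong (n ∸ x ≟ d) (d ≤? n ×-dec x ≟ n ∸ d)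
    (λ { refl → m∸n≤m n x , sym (m∸[m∸n]≡n x≤n) })
    (λ { (d≤n , refl) → m∸[m∸n]≡n d≤n }))
    (𝟙-∧ (d ≤ᵇ n) (x ≡ᵇ n ∸ d))

private
  𝟙-∧₃-* : ∀ x y z w → 𝟙 (x ∧ (y ∧ z)) * w ≡ 𝟙 x * (𝟙 y * (𝟙 z * w))
  𝟙-∧₃-* x y z w = begin
    𝟙 (x ∧ (y ∧ z)) * w       ≡⟨ cong (_* w) (trans (𝟙-∧ x _) (cong (𝟙 x *_) (𝟙-∧ y z))) ⟩
    𝟙 x * (𝟙 y * 𝟙 z) * w     ≡⟨ *-assoc (𝟙 x) _ w ⟩
    𝟙 x * (𝟙 y * 𝟙 z * w)     ≡⟨ cong (𝟙 x *_) (*-assoc (𝟙 y) (𝟙 z) w) ⟩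
    𝟙 x * (𝟙 y * (𝟙 z * w))   ∎

coeff-mono-⊗ : ∀ e r c F n a b →
  (mono e r c ⊗ F) n a b ≡ 𝟙 (e ≤ᵇ n) * (𝟙 (r ≤ᵇ a) * (𝟙 (c ≤ᵇ b) * F (n ∸ e) (a ∸ r) (b ∸ c)))
coeff-mono-⊗ e r c F n a b = begin
  (mono e r c ⊗ F) n a b
    ≡⟨ Σ-cong (range 0 n) (λ n₁ → Σ-cong (range 0 a) (λ a₁ → collapse-b n₁ a₁)) ⟩
  Σ[∈] (range 0 n) (λ n₁ → Σ[∈] (range 0 a) (λ a₁ → 𝟙 (n₁ ≡ᵇ e) * (𝟙 (a₁ ≡ᵇ r) * X n₁ a₁ c)))
    ≡⟨ Σ-cong (range 0 n) (λ n₁ → trans (sym (*-distribˡ-Σ (𝟙 (n₁ ≡ᵇ e)) (range 0 a) _))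
         (cong (𝟙 (n₁ ≡ᵇ e) *_) (Σ-range-point a r (λ a₁ → X n₁ a₁ c)))) ⟩
  Σ[∈] (range 0 n) (λ n₁ → 𝟙 (n₁ ≡ᵇ e) * (𝟙 (r ≤ᵇ a) * X n₁ r c))
    ≡⟨ Σ-range-point n e (λ n₁ → 𝟙 (r ≤ᵇ a) * X n₁ r c) ⟩
  𝟙 (e ≤ᵇ n) * (𝟙 (r ≤ᵇ a) * (𝟙 (c ≤ᵇ b) * F (n ∸ e) (a ∸ r) (b ∸ c))) ∎
  where
  X : ℕ → ℕ → ℕ → ℕ
  X n₁ a₁ b₁ = 𝟙 (c ≤ᵇ b) * F (n ∸ n₁) (a ∸ a₁) (b ∸ b₁)
  collapse-b : ∀ n₁ a₁ →
    Σ[∈] (range 0 b) (λ b₁ → mono e r c n₁ a₁ b₁ * F (n ∸ n₁) (a ∸ a₁) (b ∸ b₁)) ≡ 𝟙 (n₁ ≡ᵇ e) * (𝟙 (a₁ ≡ᵇ r) * X n₁ a₁ c)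
  collapse-b n₁ a₁ = begin
    Σ[∈] (range 0 b) (λ b₁ → mono e r c n₁ a₁ b₁ * F (n ∸ n₁) (a ∸ a₁) (b ∸ b₁))
      ≡⟨ Σ-cong (range 0 b) (λ b₁ → 𝟙-∧₃-* (n₁ ≡ᵇ e) (a₁ ≡ᵇ r) (b₁ ≡ᵇ c) _) ⟩
    Σ[∈] (range 0 b) (λ b₁ → 𝟙 (n₁ ≡ᵇ e) * (𝟙 (a₁ ≡ᵇ r) * (𝟙 (b₁ ≡ᵇ c) * F (n ∸ n₁) (a ∸ a₁) (b ∸ b₁))))
      ≡⟨ *-distribˡ-Σ (𝟙 (n₁ ≡ᵇ e)) (range 0 b) _ ⟨
    𝟙 (n₁ ≡ᵇ e) * Σ[∈] (range 0 b) (λ b₁ → 𝟙 (a₁ ≡ᵇ r) * (𝟙 (b₁ ≡ᵇ c) * F (n ∸ n₁) (a ∸ a₁) (b ∸ b₁)))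
      ≡⟨ cong (𝟙 (n₁ ≡ᵇ e) *_) (sym (*-distribˡ-Σ (𝟙 (a₁ ≡ᵇ r)) (range 0 b) _)) ⟩
    𝟙 (n₁ ≡ᵇ e) * (𝟙 (a₁ ≡ᵇ r) * Σ[∈] (range 0 b) (λ b₁ → 𝟙 (b₁ ≡ᵇ c) * F (n ∸ n₁) (a ∸ a₁) (b ∸ b₁)))
      ≡⟨ cong (λ v → 𝟙 (n₁ ≡ᵇ e) * (𝟙 (a₁ ≡ᵇ r) * v)) (Σ-range-point b c (λ b₁ → F (n ∸ n₁) (a ∸ a₁) (b ∸ b₁))) ⟩
    𝟙 (n₁ ≡ᵇ e) * (𝟙 (a₁ ≡ᵇ r) * X n₁ a₁ c) ∎

coeff-⊗-mono : ∀ F r n a b → (F ⊗ mono 0 r 0) n a b ≡ 𝟙 (r ≤ᵇ a) * F n (a ∸ r) b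
coeff-⊗-mono F r n a b = begin
  (F ⊗ mono 0 r 0) n a b
    ≡⟨ Σ-cong (range 0 n) (λ n₁ → Σ-cong (range 0 a) (λ a₁ → collapse-b n₁ a₁)) ⟩
  Σ[∈] (range 0 n) (λ n₁ → Σ[∈] (range 0 a) (λ a₁ → 𝟙 (n ∸ n₁ ≡ᵇ 0) * (𝟙 (a ∸ a₁ ≡ᵇ r) * F n₁ a₁ b)))
    ≡⟨ Σ-cong (range 0 n) (λ n₁ → trans (sym (*-distribˡ-Σ (𝟙 (n ∸ n₁ ≡ᵇ 0)) (range 0 a) _))
         (cong (𝟙 (n ∸ n₁ ≡ᵇ 0) *_) (Σ-range-point-∸ a r (λ a₁ → F n₁ a₁ b)))) ⟩
  Σ[∈] (range 0 n) (λ n₁ → 𝟙 (n ∸ n₁ ≡ᵇ 0) * (𝟙 (r ≤ᵇ a) * F n₁ (a ∸ r) b))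
    ≡⟨ Σ-range-point-∸ n 0 (λ n₁ → 𝟙 (r ≤ᵇ a) * F n₁ (a ∸ r) b) ⟩
  1 * (𝟙 (r ≤ᵇ a) * F n (a ∸ r) b)
    ≡⟨ *-identityˡ _ ⟩
  𝟙 (r ≤ᵇ a) * F n (a ∸ r) b ∎
  where
  collapse-b : ∀ n₁ a₁ →
    Σ[∈] (range 0 b) (λ b₁ → F n₁ a₁ b₁ * mono 0 r 0 (n ∸ n₁) (a ∸ a₁) (b ∸ b₁)) ≡ 𝟙 (n ∸ n₁ ≡ᵇ 0) * (𝟙 (a ∸ a₁ ≡ᵇ r) * F n₁ a₁ b)
  collapse-b n₁ a₁ = begin
    Σ[∈] (range 0 b) (λ b₁ → F n₁ a₁ b₁ * mono 0 r 0 (n ∸ n₁) (a ∸ a₁) (b ∸ b₁))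
      ≡⟨ Σ-cong (range 0 b) (λ b₁ → trans (*-comm (F n₁ a₁ b₁) _) (𝟙-∧₃-* (n ∸ n₁ ≡ᵇ 0) (a ∸ a₁ ≡ᵇ r) (b ∸ b₁ ≡ᵇ 0) _)) ⟩
    Σ[∈] (range 0 b) (λ b₁ → 𝟙 (n ∸ n₁ ≡ᵇ 0) * (𝟙 (a ∸ a₁ ≡ᵇ r) * (𝟙 (b ∸ b₁ ≡ᵇ 0) * F n₁ a₁ b₁)))
      ≡⟨ *-distribˡ-Σ (𝟙 (n ∸ n₁ ≡ᵇ 0)) (range 0 b) _ ⟨
    𝟙 (n ∸ n₁ ≡ᵇ 0) * Σ[∈] (range 0 b) (λ b₁ → 𝟙 (a ∸ a₁ ≡ᵇ r) * (𝟙 (b ∸ b₁ ≡ᵇ 0) * F n₁ a₁ b₁))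
      ≡⟨ cong (𝟙 (n ∸ n₁ ≡ᵇ 0) *_) (sym (*-distribˡ-Σ (𝟙 (a ∸ a₁ ≡ᵇ r)) (range 0 b) _)) ⟩
    𝟙 (n ∸ n₁ ≡ᵇ 0) * (𝟙 (a ∸ a₁ ≡ᵇ r) * Σ[∈] (range 0 b) (λ b₁ → 𝟙 (b ∸ b₁ ≡ᵇ 0) * F n₁ a₁ b₁))
      ≡⟨ cong (λ v → 𝟙 (n ∸ n₁ ≡ᵇ 0) * (𝟙 (a ∸ a₁ ≡ᵇ r) * v)) (trans (Σ-range-point-∸ b 0 (F n₁ a₁)) (*-identityˡ _)) ⟩
    𝟙 (n ∸ n₁ ≡ᵇ 0) * (𝟙 (a ∸ a₁ ≡ᵇ r) * F n₁ a₁ b) ∎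

coeff-geomCQ-⊗ : ∀ s i F n a b →
  (geomCQ s i ⊗ F) n a b ≡ Σ[∈] (range 0 b) (λ j → 𝟙 (s * i * j ≤ᵇ n) * F (n ∸ s * i * j) a (b ∸ j))
coeff-geomCQ-⊗ s i F n a b = begin
  (geomCQ s i ⊗ F) n a b
    ≡⟨ Σ-cong (range 0 n) collapse-a ⟩
  Σ[∈] (range 0 n) (λ n₁ → Σ[∈] (range 0 b) (λ j → 𝟙 (n₁ ≡ᵇ s * i * j) * F (n ∸ n₁) a (b ∸ j)))
    ≡⟨ Σ-comm (range 0 n) (range 0 b) _ ⟩
  Σ[∈] (range 0 b) (λ j → Σ[∈] (range 0 n) (λ n₁ → 𝟙 (n₁ ≡ᵇ s * i * j) * F (n ∸ n₁) a (b ∸ j)))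
    ≡⟨ Σ-cong (range 0 b) (λ j → Σ-range-point n (s * i * j) (λ n₁ → F (n ∸ n₁) a (b ∸ j))) ⟩
  Σ[∈] (range 0 b) (λ j → 𝟙 (s * i * j ≤ᵇ n) * F (n ∸ s * i * j) a (b ∸ j)) ∎
  where
  collapse-a : ∀ n₁ →
    Σ[∈] (range 0 a) (λ a₁ → Σ[∈] (range 0 b) (λ j → geomCQ s i n₁ a₁ j * F (n ∸ n₁) (a ∸ a₁) (b ∸ j))) ≡
    Σ[∈] (range 0 b) (λ j → 𝟙 (n₁ ≡ᵇ s * i * j) * F (n ∸ n₁) a (b ∸ j))
  collapse-a n₁ = begin
    Σ[∈] (range 0 a) (λ a₁ → Σ[∈] (range 0 b) (λ j → geomCQ s i n₁ a₁ j * F (n ∸ n₁) (a ∸ a₁) (b ∸ j)))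
      ≡⟨ Σ-cong (range 0 a) (λ a₁ → trans (Σ-cong (range 0 b) (λ j →
           trans (cong (_* F (n ∸ n₁) (a ∸ a₁) (b ∸ j)) (𝟙-∧ (a₁ ≡ᵇ 0) _)) (*-assoc (𝟙 (a₁ ≡ᵇ 0)) _ _)))
           (sym (*-distribˡ-Σ (𝟙 (a₁ ≡ᵇ 0)) (range 0 b) _))) ⟩
    Σ[∈] (range 0 a) (λ a₁ → 𝟙 (a₁ ≡ᵇ 0) * Σ[∈] (range 0 b) (λ j → 𝟙 (n₁ ≡ᵇ s * i * j) * F (n ∸ n₁) (a ∸ a₁) (b ∸ j)))
      ≡⟨ Σ-range-point a 0 _ ⟩
    1 * Σ[∈] (range 0 b) (λ j → 𝟙 (n₁ ≡ᵇ s * i * j) * F (n ∸ n₁) a (b ∸ j))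
      ≡⟨ *-identityˡ _ ⟩
    Σ[∈] (range 0 b) (λ j → 𝟙 (n₁ ≡ᵇ s * i * j) * F (n ∸ n₁) a (b ∸ j)) ∎

𝟙-shift : ∀ e n w → 𝟙 (e ≤ᵇ n) * 𝟙 (n ∸ e ≡ᵇ w) ≡ 𝟙 (n ≡ᵇ e + w)
𝟙-shift e n w = trans (sym (𝟙-∧ (e ≤ᵇ n) (n ∸ e ≡ᵇ w)))
  (𝟙-cong (e ≤? n ×-dec n ∸ e ≟ w) (n ≟ e + w)
    (λ { (e≤n , refl) → sym (m+[n∸m]≡n e≤n) })
    (λ { refl → m≤m+n e w , m+n∸m≡n e w }))

mono-shift : ∀ e r c e′ r′ c′ n a b →
  𝟙 (e ≤ᵇ n) * (𝟙 (r ≤ᵇ a) * (𝟙 (c ≤ᵇ b) * mono e′ r′ c′ (n ∸ e) (a ∸ r) (b ∸ c))) ≡ mono (e + e′) (r + r′) (c + c′) n a b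
mono-shift e r c e′ r′ c′ n a b = begin
  𝟙 (e ≤ᵇ n) * (𝟙 (r ≤ᵇ a) * (𝟙 (c ≤ᵇ b) * mono e′ r′ c′ (n ∸ e) (a ∸ r) (b ∸ c)))
    ≡⟨ cong (λ v → 𝟙 (e ≤ᵇ n) * (𝟙 (r ≤ᵇ a) * (𝟙 (c ≤ᵇ b) * v))) (𝟙-∧₃ (n ∸ e ≡ᵇ e′) (a ∸ r ≡ᵇ r′) (b ∸ c ≡ᵇ c′)) ⟩
  𝟙 (e ≤ᵇ n) * (𝟙 (r ≤ᵇ a) * (𝟙 (c ≤ᵇ b) * (𝟙 (n ∸ e ≡ᵇ e′) * (𝟙 (a ∸ r ≡ᵇ r′) * 𝟙 (b ∸ c ≡ᵇ c′)))))
    ≡⟨ interleave (𝟙 (e ≤ᵇ n)) (𝟙 (r ≤ᵇ a)) (𝟙 (c ≤ᵇ b)) _ _ _ ⟩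
  𝟙 (e ≤ᵇ n) * 𝟙 (n ∸ e ≡ᵇ e′) * (𝟙 (r ≤ᵇ a) * 𝟙 (a ∸ r ≡ᵇ r′) * (𝟙 (c ≤ᵇ b) * 𝟙 (b ∸ c ≡ᵇ c′)))
    ≡⟨ cong₂ _*_ (𝟙-shift e n e′) (cong₂ _*_ (𝟙-shift r a r′) (𝟙-shift c b c′)) ⟩
  𝟙 (n ≡ᵇ e + e′) * (𝟙 (a ≡ᵇ r + r′) * 𝟙 (b ≡ᵇ c + c′))
    ≡⟨ 𝟙-∧₃ (n ≡ᵇ e + e′) (a ≡ᵇ r + r′) (b ≡ᵇ c + c′) ⟨
  mono (e + e′) (r + r′) (c + c′) n a b ∎
  where
  𝟙-∧₃ : ∀ x y z → 𝟙 (x ∧ (y ∧ z)) ≡ 𝟙 x * (𝟙 y * 𝟙 z)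
  𝟙-∧₃ x y z = trans (𝟙-∧ x _) (cong (𝟙 x *_) (𝟙-∧ y z))
  interleave : ∀ p₁ p₂ p₃ q₁ q₂ q₃ → p₁ * (p₂ * (p₃ * (q₁ * (q₂ * q₃)))) ≡ p₁ * q₁ * (p₂ * q₂ * (p₃ * q₃))
  interleave = solve-∀

-- F = Σ_{y ∈ I n a b} q^(q y) R^(r y) C^(c y) as far as the coefficient of
-- q^n R^a C^b is concerned: the index list may depend on the coefficient.
record IsMonomialSum {Y : Set} (F : Series) (I : ℕ → ℕ → ℕ → List Y) (q r c : Y → ℕ) : Set where
  constructor monomialSum
  field coefficient : ∀ n a b → F n a b ≡ Σ[∈] (I n a b) (λ y → mono (q y) (r y) (c y) n a b)

open IsMonomialSum public

module _ {Y : Set} {F : Series} {I : ℕ → ℕ → ℕ → List Y} {q r c : Y → ℕ} where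

  mono-⊗-monomialSum : ∀ e₀ r₀ c₀ → IsMonomialSum F I q r c →
    IsMonomialSum (mono e₀ r₀ c₀ ⊗ F) (λ n a b → I (n ∸ e₀) (a ∸ r₀) (b ∸ c₀))
                  (λ y → e₀ + q y) (λ y → r₀ + r y) (λ y → c₀ + c y)
  mono-⊗-monomialSum e₀ r₀ c₀ F≡ = monomialSum λ n a b → let I′ = I (n ∸ e₀) (a ∸ r₀) (b ∸ c₀) in begin
    (mono e₀ r₀ c₀ ⊗ F) n a b
      ≡⟨ coeff-mono-⊗ e₀ r₀ c₀ F n a b ⟩
    𝟙 (e₀ ≤ᵇ n) * (𝟙 (r₀ ≤ᵇ a) * (𝟙 (c₀ ≤ᵇ b) * F (n ∸ e₀) (a ∸ r₀) (b ∸ c₀)))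
      ≡⟨ cong (λ v → 𝟙 (e₀ ≤ᵇ n) * (𝟙 (r₀ ≤ᵇ a) * (𝟙 (c₀ ≤ᵇ b) * v))) (coefficient F≡ (n ∸ e₀) (a ∸ r₀) (b ∸ c₀)) ⟩
    𝟙 (e₀ ≤ᵇ n) * (𝟙 (r₀ ≤ᵇ a) * (𝟙 (c₀ ≤ᵇ b) * Σ[∈] I′ (λ y → mono (q y) (r y) (c y) (n ∸ e₀) (a ∸ r₀) (b ∸ c₀))))
      ≡⟨ cong (λ v → 𝟙 (e₀ ≤ᵇ n) * (𝟙 (r₀ ≤ᵇ a) * v)) (*-distribˡ-Σ (𝟙 (c₀ ≤ᵇ b)) I′ _) ⟩
    𝟙 (e₀ ≤ᵇ n) * (𝟙 (r₀ ≤ᵇ a) * Σ[∈] I′ (λ y → 𝟙 (c₀ ≤ᵇ b) * mono (q y) (r y) (c y) (n ∸ e₀) (a ∸ r₀) (b ∸ c₀)))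
      ≡⟨ cong (𝟙 (e₀ ≤ᵇ n) *_) (*-distribˡ-Σ (𝟙 (r₀ ≤ᵇ a)) I′ _) ⟩
    𝟙 (e₀ ≤ᵇ n) * Σ[∈] I′ (λ y → 𝟙 (r₀ ≤ᵇ a) * (𝟙 (c₀ ≤ᵇ b) * mono (q y) (r y) (c y) (n ∸ e₀) (a ∸ r₀) (b ∸ c₀)))
      ≡⟨ *-distribˡ-Σ (𝟙 (e₀ ≤ᵇ n)) I′ _ ⟩
    Σ[∈] I′ (λ y → 𝟙 (e₀ ≤ᵇ n) * (𝟙 (r₀ ≤ᵇ a) * (𝟙 (c₀ ≤ᵇ b) * mono (q y) (r y) (c y) (n ∸ e₀) (a ∸ r₀) (b ∸ c₀))))
      ≡⟨ Σ-cong I′ (λ y → mono-shift e₀ r₀ c₀ (q y) (r y) (c y) n a b) ⟩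
    Σ[∈] I′ (λ y → mono (e₀ + q y) (r₀ + r y) (c₀ + c y) n a b) ∎

  monomialSum-⊗-mono : ∀ r₀ → IsMonomialSum F I q r c →
    IsMonomialSum (F ⊗ mono 0 r₀ 0) (λ n a b → I n (a ∸ r₀) b) q (λ y → r₀ + r y) c
  monomialSum-⊗-mono r₀ F≡ = monomialSum λ n a b → let I′ = I n (a ∸ r₀) b in begin
    (F ⊗ mono 0 r₀ 0) n a b
      ≡⟨ coeff-⊗-mono F r₀ n a b ⟩
    𝟙 (r₀ ≤ᵇ a) * F n (a ∸ r₀) b
      ≡⟨ cong (𝟙 (r₀ ≤ᵇ a) *_) (coefficient F≡ n (a ∸ r₀) b) ⟩
    𝟙 (r₀ ≤ᵇ a) * Σ[∈] I′ (λ y → mono (q y) (r y) (c y) n (a ∸ r₀) b)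
      ≡⟨ *-distribˡ-Σ (𝟙 (r₀ ≤ᵇ a)) I′ _ ⟩
    Σ[∈] I′ (λ y → 𝟙 (r₀ ≤ᵇ a) * mono (q y) (r y) (c y) n (a ∸ r₀) b)
      ≡⟨ Σ-cong I′ (λ y → trans (pad (𝟙 (r₀ ≤ᵇ a)) _) (mono-shift 0 r₀ 0 (q y) (r y) (c y) n a b)) ⟩
    Σ[∈] I′ (λ y → mono (q y) (r₀ + r y) (c y) n a b) ∎
    where
    pad : ∀ x y → x * y ≡ 1 * (x * (1 * y))
    pad = solve-∀

boundedVectors : List ℕ → ℕ → List (List ℕ)
boundedVectors [] b = [] ∷ []
boundedVectors (i ∷ is) b = concatMap (λ j → map (j ∷_) (boundedVectors is (b ∸ j))) (range 0 b)

infixl 7 _·_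
_·_ : List ℕ → List ℕ → ℕ
(i ∷ is) · (j ∷ js) = i * j + is · js
_ · _ = 0

geomProduct : ℕ → List ℕ → Series
geomProduct s is = foldr (λ i F → geomCQ s i ⊗ F) one is

geomProduct-coefficient : ∀ s is n a b →
  geomProduct s is n a b ≡ Σ[∈] (boundedVectors is b) (λ js → mono (s * (is · js)) 0 (sum js) n a b)
geomProduct-coefficient s [] n a b =
  trans (cong (λ e → mono e 0 0 n a b) (sym (*-zeroʳ s))) (sym (+-identityʳ _))
geomProduct-coefficient s (i ∷ is) n a b = begin
  (geomCQ s i ⊗ geomProduct s is) n a b
    ≡⟨ coeff-geomCQ-⊗ s i (geomProduct s is) n a b ⟩
  Σ[∈] (range 0 b) (λ j → 𝟙 (s * i * j ≤ᵇ n) * geomProduct s is (n ∸ s * i * j) a (b ∸ j))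
    ≡⟨ Σ-cong-∈ (range 0 b) (λ j∈ → first-exponent (proj₂ (∈-range⁻ 0 b j∈))) ⟩
  Σ[∈] (range 0 b) (λ j → Σ[∈] (map (j ∷_) (boundedVectors is (b ∸ j))) term)
    ≡⟨ Σ-concatMap (λ j → map (j ∷_) (boundedVectors is (b ∸ j))) (range 0 b) term ⟨
  Σ[∈] (boundedVectors (i ∷ is) b) term ∎
  where
  term : List ℕ → ℕ
  term js = mono (s * ((i ∷ is) · js)) 0 (sum js) n a b
  first-exponent : ∀ {j} → j ≤ b →
    𝟙 (s * i * j ≤ᵇ n) * geomProduct s is (n ∸ s * i * j) a (b ∸ j) ≡ Σ[∈] (map (j ∷_) (boundedVectors is (b ∸ j))) term
  first-exponent {j} j≤b = begin
    𝟙 (s * i * j ≤ᵇ n) * geomProduct s is (n ∸ s * i * j) a (b ∸ j)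
      ≡⟨ cong (𝟙 (s * i * j ≤ᵇ n) *_) (geomProduct-coefficient s is (n ∸ s * i * j) a (b ∸ j)) ⟩
    𝟙 (s * i * j ≤ᵇ n) * Σ[∈] vs (λ js → mono (s * (is · js)) 0 (sum js) (n ∸ s * i * j) a (b ∸ j))
      ≡⟨ *-distribˡ-Σ (𝟙 (s * i * j ≤ᵇ n)) vs _ ⟩
    Σ[∈] vs (λ js → 𝟙 (s * i * j ≤ᵇ n) * mono (s * (is · js)) 0 (sum js) (n ∸ s * i * j) a (b ∸ j))
      ≡⟨ Σ-cong vs shift-j ⟩
    Σ[∈] vs (λ js → term (j ∷ js))
      ≡⟨ Σ-map (j ∷_) vs term ⟨
    Σ[∈] (map (j ∷_) vs) term ∎
    where
    vs : List (List ℕ)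
    vs = boundedVectors is (b ∸ j)
    shift-j : ∀ js → 𝟙 (s * i * j ≤ᵇ n) * mono (s * (is · js)) 0 (sum js) (n ∸ s * i * j) a (b ∸ j) ≡ term (j ∷ js)
    shift-j js = begin
      𝟙 (s * i * j ≤ᵇ n) * X
        ≡⟨ cong (𝟙 (s * i * j ≤ᵇ n) *_) (sym (trans (*-identityˡ _) (trans (cong (_* X) (𝟙-yes (j ≤? b) j≤b)) (*-identityˡ X)))) ⟩
      𝟙 (s * i * j ≤ᵇ n) * (1 * (𝟙 (j ≤ᵇ b) * X))
        ≡⟨ mono-shift (s * i * j) 0 j (s * (is · js)) 0 (sum js) n a b ⟩
      mono (s * i * j + s * (is · js)) 0 (j + sum js) n a b
        ≡⟨ cong (λ e → mono e 0 (j + sum js) n a b) (factor-s s i j (is · js)) ⟩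
      term (j ∷ js) ∎
      where
      X : ℕ
      X = mono (s * (is · js)) 0 (sum js) (n ∸ s * i * j) a (b ∸ j)
      factor-s : ∀ s i j x → s * i * j + s * x ≡ s * (i * j + x)
      factor-s = solve-∀

geomProduct-monomialSum : ∀ s is →
  IsMonomialSum (geomProduct s is) (λ _ _ b → boundedVectors is b) (λ js → s * (is · js)) (λ _ → 0) sum
geomProduct-monomialSum s is = monomialSum (geomProduct-coefficient s is)

length-∈-boundedVectors : ∀ is b {js} → js ∈ boundedVectors is b → length js ≡ length is
length-∈-boundedVectors [] b (here refl) = refl
length-∈-boundedVectors (i ∷ is) b js∈
  with j , js , _ , js∈′ , refl ← ∈-concatMap-map⁻ _∷_ (λ j → boundedVectors is (b ∸ j)) (range 0 b) js∈
  = cong suc (length-∈-boundedVectors is (b ∸ j) js∈′)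

weightedSum : ℕ → List ℕ → ℕ
weightedSum i [] = 0
weightedSum i (e ∷ es) = i * e + weightedSum (suc i) es

interval-· : ∀ i es → interval i (length es) · es ≡ weightedSum i es
interval-· i [] = refl
interval-· i (e ∷ es) = cong (i * e +_) (interval-· (suc i) es)

module RHSExpansion (s : ℕ) .{{_ : NonZero s}} (ρ : List ℕ) where

  m : ℕ
  m = length ρ

  -- A term of the bracket: k = 0 stands for R^(γ_m - m); otherwise js is an
  -- exponent vector of 1/(CQ;Q)_k, which multiplies C Q^k R^max(γ_m - m, k - m).
  Bracket : Set
  Bracket = ℕ × List ℕ

  brackets : ℕ → ℕ → List Bracket
  brackets N b = (0 , []) ∷ concatMap (λ k → map (k ,_) (boundedVectors (range 1 k) (b ∸ 1))) (range 1 N)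

  bracketQ : Bracket → ℕ
  bracketQ (k , js) = s * (k + weightedSum 1 js)

  bracketR : ℕ → Bracket → ℕ
  bracketR g (k , _) = (g ⊔ k) ∸ m

  bracketC : Bracket → ℕ
  bracketC (zero , _) = 0
  bracketC (suc _ , js) = suc (sum js)

  innerTerm-monomialSum : ∀ g k → 1 ≤ k →
    IsMonomialSum (innerTerm s m g k) (λ _ _ b → map (k ,_) (boundedVectors (range 1 k) (b ∸ 1)))
                  bracketQ (bracketR g) bracketC
  innerTerm-monomialSum g k@(suc _) _ = monomialSum λ N a b → let vs = boundedVectors (range 1 k) (b ∸ 1) in begin
    innerTerm s m g k N a b
      ≡⟨ coefficient (mono-⊗-monomialSum (s * k) 0 1 (monomialSum-⊗-mono M (geomProduct-monomialSum s (range 1 k)))) N a b ⟩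
    Σ[∈] vs (λ js → mono (s * k + s * (range 1 k · js)) (M + 0) (suc (sum js)) N a b)
      ≡⟨ Σ-cong-∈ vs (λ {js} js∈ → cong₂ (λ q r → mono q r (suc (sum js)) N a b)
           (q-degree {js} (length-∈-boundedVectors (range 1 k) (b ∸ 1) js∈)) r-degree) ⟩
    Σ[∈] vs (λ js → mono (bracketQ (k , js)) (bracketR g (k , js)) (bracketC (k , js)) N a b)
      ≡⟨ Σ-map (k ,_) vs (λ t → mono (bracketQ t) (bracketR g t) (bracketC t) N a b) ⟨
    Σ[∈] (map (k ,_) vs) (λ t → mono (bracketQ t) (bracketR g t) (bracketC t) N a b) ∎
    where
    M : ℕ
    M = (g ∸ m) ⊔ (k ∸ m)
    q-degree : ∀ {js} → length js ≡ length (range 1 k) → s * k + s * (range 1 k · js) ≡ s * (k + weightedSum 1 js)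
    q-degree {js} len = begin
      s * k + s * (range 1 k · js)      ≡⟨ cong (λ is → s * k + s * (is · js)) (range≡interval 1 k) ⟩
      s * k + s * (interval 1 k · js)   ≡⟨ cong (λ c → s * k + s * (interval 1 c · js)) k≡len ⟩
      s * k + s * (interval 1 (length js) · js) ≡⟨ cong (λ x → s * k + s * x) (interval-· 1 js) ⟩
      s * k + s * weightedSum 1 js      ≡⟨ *-distribˡ-+ s k _ ⟨
      s * (k + weightedSum 1 js)        ∎
      where
      k≡len : k ≡ length js
      k≡len = sym (trans len (trans (cong length (range≡interval 1 k)) (length-interval 1 k)))
    r-degree : M + 0 ≡ (g ⊔ k) ∸ m
    r-degree = trans (+-identityʳ M) (sym (∸-distribʳ-⊔ m g k))

  inner-monomialSum : ∀ g → IsMonomialSum (inner s m g) (λ N _ b → brackets N b) bracketQ (bracketR g) bracketC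
  inner-monomialSum g = monomialSum λ N a b → cong₂ _+_ (constant-term N a b) (begin
    Σ[∈] (range 1 N) (λ k → innerTerm s m g k N a b)
      ≡⟨ Σ-cong-∈ (range 1 N) (λ k∈ → coefficient (innerTerm-monomialSum g _ (proj₁ (∈-range⁻ 1 N k∈))) N a b) ⟩
    Σ[∈] (range 1 N) (λ k → Σ[∈] (map (k ,_) (boundedVectors (range 1 k) (b ∸ 1))) (term N a b))
      ≡⟨ Σ-concatMap (λ k → map (k ,_) (boundedVectors (range 1 k) (b ∸ 1))) (range 1 N) (term N a b) ⟨
    Σ[∈] (concatMap (λ k → map (k ,_) (boundedVectors (range 1 k) (b ∸ 1))) (range 1 N)) (term N a b) ∎)
    where
    term : ℕ → ℕ → ℕ → Bracket → ℕ
    term N a b t = mono (bracketQ t) (bracketR g t) (bracketC t) N a b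
    constant-term : ∀ N a b → mono 0 (g ∸ m) 0 N a b ≡ term N a b (0 , [])
    constant-term N a b = cong₂ (λ q r → mono q r 0 N a b) (sym (*-zeroʳ s)) (cong (_∸ m) (sym (⊔-identityʳ g)))

  Term : Set
  Term = List ℕ × Bracket

  γTerms : ℕ → ℕ → List Term
  γTerms N b = concatMap (λ γ → map (γ ,_) (brackets (N ∸ s * dExp ρ γ) b)) (incSeqs m 1 (N + m))

  terms : ℕ → ℕ → ℕ → List Term
  terms n _ b = γTerms (n ∸ sum ρ) b

  termQ : Term → ℕ
  termQ (γ , t) = sum ρ + (s * dExp ρ γ + bracketQ t)

  termR : Term → ℕ
  termR (γ , t) = bracketR (lastOr0 γ) t

  termC : Term → ℕ
  termC (γ , t) = bracketC t

  γSum-monomialSum : IsMonomialSum (γSum s ρ) (λ N _ b → γTerms N b) (λ (γ , t) → s * dExp ρ γ + bracketQ t) termR termC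
  γSum-monomialSum = monomialSum λ N a b → let term = λ (γ , t) → mono (s * dExp ρ γ + bracketQ t) (termR (γ , t)) (termC (γ , t)) N a b in begin
    Σ[∈] (incSeqs m 1 (N + m)) (λ γ → γTerm s ρ γ N a b)
      ≡⟨ Σ-cong (incSeqs m 1 (N + m)) (λ γ → trans
           (coefficient (mono-⊗-monomialSum (s * dExp ρ γ) 0 0 (inner-monomialSum (lastOr0 γ))) N a b)
           (sym (Σ-map (γ ,_) (brackets (N ∸ s * dExp ρ γ) b) term))) ⟩
    Σ[∈] (incSeqs m 1 (N + m)) (λ γ → Σ[∈] (map (γ ,_) (brackets (N ∸ s * dExp ρ γ) b)) term)
      ≡⟨ Σ-concatMap (λ γ → map (γ ,_) (brackets (N ∸ s * dExp ρ γ) b)) (incSeqs m 1 (N + m)) term ⟨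
    Σ[∈] (γTerms N b) term ∎

  RHS-monomialSum : IsMonomialSum (RHS s ρ) terms termQ termR termC
  RHS-monomialSum = mono-⊗-monomialSum (sum ρ) 0 0 γSum-monomialSum

-- Partitions as residue and excess words

headOr0 : List ℕ → ℕ
headOr0 [] = 0
headOr0 (x ∷ _) = x

lastOr0-∷ : ∀ x w → 1 ≤ length w → lastOr0 (x ∷ w) ≡ lastOr0 w
lastOr0-∷ x (_ ∷ _) _ = refl

lastOr0-positive⇒nonempty : ∀ {w} → 1 ≤ lastOr0 w → 1 ≤ length w
lastOr0-positive⇒nonempty {_ ∷ _} _ = s≤s z≤n

lastOr0-positive : ∀ {xs} → All (1 ≤_) xs → 1 ≤ length xs → 1 ≤ lastOr0 xs
lastOr0-positive {_ ∷ []} (1≤x ∷ []) _ = 1≤x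
lastOr0-positive {_ ∷ _ ∷ _} (_ ∷ rest) _ = lastOr0-positive rest (s≤s z≤n)

lastOr0-≤ : ∀ {c xs} → All (_≤ c) xs → lastOr0 xs ≤ c
lastOr0-≤ [] = z≤n
lastOr0-≤ (x≤c ∷ []) = x≤c
lastOr0-≤ (_ ∷ rest@(_ ∷ _)) = lastOr0-≤ rest

headOr0-≤-sum : ∀ xs → headOr0 xs ≤ sum xs
headOr0-≤-sum [] = z≤n
headOr0-≤-sum (x ∷ xs) = m≤m+n x (sum xs)

data IsPartition : List ℕ → Set where
  [] : IsPartition []
  cons : ∀ {x xs} → headOr0 xs ≤ x → 1 ≤ x → IsPartition xs → IsPartition (x ∷ xs)

count-map : ∀ {A : Set} (p : ℕ → Bool) (f : A → ℕ) xs → count p (map f xs) ≡ count (λ x → p (f x)) xs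
count-map p f [] = refl
count-map p f (x ∷ xs) = cong (𝟙 (p (f x)) +_) (count-map p f xs)

count-cong-∈ : ∀ {A : Set} {p q : A → Bool} xs → (∀ {x} → x ∈ xs → p x ≡ q x) → count p xs ≡ count q xs
count-cong-∈ [] _ = refl
count-cong-∈ (x ∷ xs) p≡q = cong₂ (λ b c → 𝟙 b + c) (p≡q (here refl)) (count-cong-∈ xs (λ x∈ → p≡q (there x∈)))

ascentIndexSum : ℕ → List ℕ → ℕ
ascentIndexSum i [] = 0
ascentIndexSum i (r ∷ rs) = 𝟙 (r <ᵇ headOr0 rs) * i + ascentIndexSum (suc i) rs

nonzeros : List ℕ → List ℕ
nonzeros [] = []
nonzeros (r ∷ rs) = if r ≡ᵇ 0 then nonzeros rs else r ∷ nonzeros rs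

countZeros : List ℕ → ℕ
countZeros = count (_≡ᵇ 0)

IsPartition-≤-head : ∀ {y ys} → IsPartition (y ∷ ys) → All (_≤ y) ys
IsPartition-≤-head {ys = []} _ = []
IsPartition-≤-head {ys = _ ∷ _} (cons z≤y _ p) = z≤y ∷ All.map (λ w≤z → ≤-trans w≤z z≤y) (IsPartition-≤-head p)

IsPartition-last : ∀ {xs} → IsPartition xs → 1 ≤ length xs → 1 ≤ lastOr0 xs
IsPartition-last (cons _ 1≤x []) _ = 1≤x
IsPartition-last (cons _ _ p@(cons _ _ _)) _ = IsPartition-last p (s≤s z≤n)

legZero : ∀ {j rest} → 1 ≤ j → IsPartition rest →
  (length (filter (λ r → j ≤? r) rest) ≡ᵇ 0) ≡ (headOr0 rest <ᵇ j)
legZero {j} {[]} 1≤j _ = sym (dec-true (0 <? j) 1≤j)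
legZero {j} {y ∷ ys} _ p = does-cong (length (filter (j ≤?_) (y ∷ ys)) ≟ 0) (y <? j)
  (λ len≡0 → ≰⇒> λ j≤y → <⇒≢ (filter-some (j ≤?_) (here j≤y)) (sym len≡0))
  (λ y<j → cong length (filter-none (j ≤?_) (All.map (λ z≤y j≤z → <⇒≱ y<j (≤-trans j≤z z≤y)) (≤-refl ∷ IsPartition-≤-head p))))

module Encoding (s : ℕ) .{{_ : NonZero s}} where

  0<s : 0 < s
  0<s = >-nonZero⁻¹ s

  -- (r − r′) mod s, for residues r, r′ < s
  diffMod : ℕ → ℕ → ℕ
  diffMod r r′ = if r′ ≤ᵇ r then r ∸ r′ else s + r ∸ r′

  diffMod-≤ : ∀ {r r′} → r′ ≤ r → diffMod r r′ ≡ r ∸ r′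
  diffMod-≤ {r} {r′} r′≤r rewrite dec-true (r′ ≤? r) r′≤r = refl

  diffMod-> : ∀ {r r′} → r < r′ → diffMod r r′ ≡ s + r ∸ r′
  diffMod-> {r} {r′} r<r′ rewrite dec-false (r′ ≤? r) (<⇒≱ r<r′) = refl

  diffMod-< : ∀ {r r′} → r < s → r′ < s → diffMod r r′ < s
  diffMod-< {r} {r′} r<s r′<s with r′ ≤? r
  ... | yes r′≤r = subst (_< s) (sym (diffMod-≤ r′≤r)) (≤-<-trans (m∸n≤m r r′) r<s)
  ... | no r′≰r = subst (_< s) (sym (diffMod-> (≰⇒> r′≰r)))
    (subst (s + r ∸ r′ <_) (m+n∸n≡m s r) (∸-monoʳ-< (≰⇒> r′≰r) (≤-trans (<⇒≤ r′<s) (m≤m+n s r))))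

  -- The carry 𝟙 (r <ᵇ r′) is what produces the ascent statistic.
  diffMod-+ : ∀ r {r′} → r′ < s → diffMod r r′ + r′ ≡ r + s * 𝟙 (r <ᵇ r′)
  diffMod-+ r {r′} r′<s with r <? r′
  ... | yes r<r′ = begin
    diffMod r r′ + r′       ≡⟨ cong (_+ r′) (diffMod-> r<r′) ⟩
    s + r ∸ r′ + r′         ≡⟨ m∸n+n≡m (≤-trans (<⇒≤ r′<s) (m≤m+n s r)) ⟩
    s + r                   ≡⟨ +-comm s r ⟩
    r + s                   ≡⟨ cong (r +_) (*-identityʳ s) ⟨
    r + s * 1               ≡⟨ cong (λ c → r + s * c) (𝟙-yes (r <? r′) r<r′) ⟨
    r + s * 𝟙 (r <ᵇ r′)     ∎
  ... | no r≮r′ = begin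
    diffMod r r′ + r′       ≡⟨ cong (_+ r′) (diffMod-≤ (≮⇒≥ r≮r′)) ⟩
    r ∸ r′ + r′             ≡⟨ m∸n+n≡m (≮⇒≥ r≮r′) ⟩
    r                       ≡⟨ +-identityʳ r ⟨
    r + 0                   ≡⟨ cong (r +_) (*-zeroʳ s) ⟨
    r + s * 0               ≡⟨ cong (λ c → r + s * c) (𝟙-no (r <? r′) r≮r′) ⟨
    r + s * 𝟙 (r <ᵇ r′)     ∎

  diffMod-%-+ : ∀ {a c} → a < s → c < s → diffMod ((a + c) % s) a ≡ c
  diffMod-%-+ {a} {c} a<s c<s with a + c <? s
  ... | yes a+c<s = begin
    diffMod ((a + c) % s) a ≡⟨ cong (λ r → diffMod r a) (m<n⇒m%n≡m a+c<s) ⟩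
    diffMod (a + c) a       ≡⟨ diffMod-≤ (m≤m+n a c) ⟩
    a + c ∸ a               ≡⟨ m+n∸m≡n a c ⟩
    c                       ∎
  ... | no a+c≮s = begin
    diffMod ((a + c) % s) a ≡⟨ cong (λ r → diffMod r a) wrapped ⟩
    diffMod (a + c ∸ s) a   ≡⟨ diffMod-> wrapped<a ⟩
    s + (a + c ∸ s) ∸ a     ≡⟨ cong (_∸ a) (m+[n∸m]≡n s≤a+c) ⟩
    a + c ∸ a               ≡⟨ m+n∸m≡n a c ⟩
    c                       ∎
    where
    s≤a+c : s ≤ a + c
    s≤a+c = ≮⇒≥ a+c≮s
    wrapped<a : a + c ∸ s < a
    wrapped<a = +-cancelʳ-< s _ _ (subst (_< a + s) (sym (m∸n+n≡m s≤a+c)) (+-monoʳ-< a c<s))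
    wrapped : (a + c) % s ≡ a + c ∸ s
    wrapped = trans (sym (m≤n⇒[n∸m]%m≡n%m s≤a+c)) (m<n⇒m%n≡m (<-≤-trans wrapped<a (<⇒≤ a<s)))

  /-+-< : ∀ e {d} → d < s → (s * e + d) / s ≡ e
  /-+-< e {d} d<s = begin
    (s * e + d) / s    ≡⟨ /-congˡ (cong (_+ d) (*-comm s e)) ⟩
    (e * s + d) / s    ≡⟨ +-distrib-/-∣ˡ d (divides-refl e) ⟩
    e * s / s + d / s  ≡⟨ cong₂ _+_ (m*n/n≡m e s) (m<n⇒m/n≡0 d<s) ⟩
    e + 0              ≡⟨ +-identityʳ e ⟩
    e                  ∎

  %-+-* : ∀ d e → (s * e + d) % s ≡ d % s
  %-+-* d e = trans (cong (_% s) (trans (+-comm (s * e) d) (cong (d +_) (*-comm s e)))) ([m+kn]%n≡m%n d e s)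

  residues : List ℕ → List ℕ
  residues = map (_% s)

  excesses : List ℕ → List ℕ
  excesses [] = []
  excesses (x ∷ xs) = (x ∸ headOr0 xs) / s ∷ excesses xs

  length-excesses : ∀ xs → length (excesses xs) ≡ length xs
  length-excesses [] = refl
  length-excesses (x ∷ xs) = cong suc (length-excesses xs)

  -- Row i is row i+1 plus s e_i plus the gap (r_i − r_{i+1}) mod s.
  fromWords : List ℕ → List ℕ → List ℕ
  fromWords (r ∷ rs) (e ∷ es) = headOr0 rows + (s * e + diffMod r (headOr0 rs)) ∷ rows
    where rows = fromWords rs es
  fromWords _ _ = []

  headOr0-residues : ∀ xs → headOr0 (residues xs) ≡ headOr0 xs % s
  headOr0-residues [] = sym (m<n⇒m%n≡m 0<s)
  headOr0-residues (x ∷ xs) = refl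

  headOr0-< : ∀ {rs} → All (_< s) rs → headOr0 rs < s
  headOr0-< [] = 0<s
  headOr0-< (r<s ∷ _) = r<s

  residues-fromWords : ∀ rs es → All (_< s) rs → length rs ≡ length es → residues (fromWords rs es) ≡ rs
  residues-fromWords [] [] _ _ = refl
  residues-fromWords (r ∷ rs) (e ∷ es) (r<s ∷ rs<s) len = cong₂ _∷_ head-residue ih
    where
    ih : residues (fromWords rs es) ≡ rs
    ih = residues-fromWords rs es rs<s (suc-injective len)
    h : ℕ
    h = headOr0 (fromWords rs es)
    r′ : ℕ
    r′ = headOr0 rs
    d : ℕ
    d = diffMod r r′
    h%s≡r′ : h % s ≡ r′
    h%s≡r′ = trans (sym (headOr0-residues (fromWords rs es))) (cong headOr0 ih)
    head-residue : (h + (s * e + d)) % s ≡ r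
    head-residue = begin
      (h + (s * e + d)) % s               ≡⟨ %-distribˡ-+ h _ s ⟩
      (h % s + (s * e + d) % s) % s       ≡⟨ cong₂ (λ x y → (x + y) % s) h%s≡r′ (trans (%-+-* d e) (m<n⇒m%n≡m (diffMod-< r<s (headOr0-< rs<s)))) ⟩
      (r′ + d) % s                        ≡⟨ cong (_% s) (trans (+-comm r′ d) (diffMod-+ r (headOr0-< rs<s))) ⟩
      (r + s * 𝟙 (r <ᵇ r′)) % s          ≡⟨ trans (cong (_% s) (cong (r +_) (*-comm s _))) ([m+kn]%n≡m%n r (𝟙 (r <ᵇ r′)) s) ⟩
      r % s                               ≡⟨ m<n⇒m%n≡m r<s ⟩
      r                                   ∎

  excesses-fromWords : ∀ rs es → All (_< s) rs → length rs ≡ length es → excesses (fromWords rs es) ≡ es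
  excesses-fromWords [] [] _ _ = refl
  excesses-fromWords (r ∷ rs) (e ∷ es) (r<s ∷ rs<s) len = cong₂ _∷_
    (trans (/-congˡ (m+n∸m≡n (headOr0 (fromWords rs es)) _)) (/-+-< e (diffMod-< r<s (headOr0-< rs<s))))
    (excesses-fromWords rs es rs<s (suc-injective len))

  fromWords-residues-excesses : ∀ {xs} → IsPartition xs → fromWords (residues xs) (excesses xs) ≡ xs
  fromWords-residues-excesses [] = refl
  fromWords-residues-excesses {x ∷ xs} (cons h≤x _ p) = cong₂ _∷_ head-row (fromWords-residues-excesses p)
    where
    h : ℕ
    h = headOr0 xs
    D : ℕ
    D = x ∸ h
    gap : diffMod (x % s) (headOr0 (residues xs)) ≡ D % s
    gap = begin
      diffMod (x % s) (headOr0 (residues xs))   ≡⟨ cong₂ diffMod (cong (_% s) (sym (m+[n∸m]≡n h≤x))) (headOr0-residues xs) ⟩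
      diffMod ((h + D) % s) (h % s)             ≡⟨ cong (λ r → diffMod r (h % s)) (%-distribˡ-+ h D s) ⟩
      diffMod ((h % s + D % s) % s) (h % s)     ≡⟨ diffMod-%-+ (m%n<n h s) (m%n<n D s) ⟩
      D % s                                     ∎
    head-row : headOr0 (fromWords (residues xs) (excesses xs)) + (s * (D / s) + diffMod (x % s) (headOr0 (residues xs))) ≡ x
    head-row = begin
      headOr0 (fromWords (residues xs) (excesses xs)) + (s * (D / s) + diffMod (x % s) (headOr0 (residues xs)))
        ≡⟨ cong₂ (λ y z → headOr0 y + (s * (D / s) + z)) (fromWords-residues-excesses p) gap ⟩
      h + (s * (D / s) + D % s)   ≡⟨ cong (h +_) (trans (+-comm _ (D % s)) (cong (D % s +_) (*-comm s (D / s)))) ⟩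
      h + (D % s + D / s * s)     ≡⟨ cong (h +_) (m≡m%n+[m/n]*n D s) ⟨
      h + D                       ≡⟨ m+[n∸m]≡n h≤x ⟩
      x                           ∎

  -- Σᵢ λᵢ = Σᵢ i (λᵢ − λᵢ₊₁); the offset j shifts every index i to i + j.
  sum-fromWords-from : ∀ j rs es → All (_< s) rs → length rs ≡ length es →
    j * headOr0 (fromWords rs es) + sum (fromWords rs es) ≡
    s * weightedSum (suc j) es + (j * headOr0 rs + sum rs + s * ascentIndexSum (suc j) rs)
  sum-fromWords-from j [] [] _ _ = solve-∀-zero j s
    where
    solve-∀-zero : ∀ j s → j * 0 + 0 ≡ s * 0 + (j * 0 + 0 + s * 0)
    solve-∀-zero = solve-∀
  sum-fromWords-from j (r ∷ rs) (e ∷ es) (r<s ∷ rs<s) len = begin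
    j * x + (x + sum rows)
      ≡⟨ expand j H s e d (sum rows) ⟩
    (suc j * H + sum rows) + suc j * (s * e) + suc j * d
      ≡⟨ cong (λ v → v + suc j * (s * e) + suc j * d) (sum-fromWords-from (suc j) rs es rs<s (suc-injective len)) ⟩
    s * W + (suc j * r′ + sum rs + s * Asc) + suc j * (s * e) + suc j * d
      ≡⟨ regroup j s W r′ (sum rs) Asc e d ⟩
    s * (suc j * e + W) + (sum rs + s * Asc) + suc j * (d + r′)
      ≡⟨ cong (λ v → s * (suc j * e + W) + (sum rs + s * Asc) + suc j * v) (diffMod-+ r (headOr0-< rs<s)) ⟩
    s * (suc j * e + W) + (sum rs + s * Asc) + suc j * (r + s * 𝟙 (r <ᵇ r′))
      ≡⟨ collect j s e W (sum rs) Asc r (𝟙 (r <ᵇ r′)) ⟩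
    s * (suc j * e + W) + (j * r + (r + sum rs) + s * (𝟙 (r <ᵇ r′) * suc j + Asc)) ∎
    where
    rows : List ℕ
    rows = fromWords rs es
    H : ℕ
    H = headOr0 rows
    r′ : ℕ
    r′ = headOr0 rs
    d : ℕ
    d = diffMod r r′
    x : ℕ
    x = H + (s * e + d)
    W : ℕ
    W = weightedSum (suc (suc j)) es
    Asc : ℕ
    Asc = ascentIndexSum (suc (suc j)) rs
    expand : ∀ j H s e d t → j * (H + (s * e + d)) + (H + (s * e + d) + t) ≡ (suc j * H + t) + suc j * (s * e) + suc j * d
    expand = solve-∀
    regroup : ∀ j s W r′ t Asc e d → s * W + (suc j * r′ + t + s * Asc) + suc j * (s * e) + suc j * d ≡ s * (suc j * e + W) + (t + s * Asc) + suc j * (d + r′)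
    regroup = solve-∀
    collect : ∀ j s e W t Asc r c → s * (suc j * e + W) + (t + s * Asc) + suc j * (r + s * c) ≡ s * (suc j * e + W) + (j * r + (r + t) + s * (c * suc j + Asc))
    collect = solve-∀

  sum-fromWords : ∀ rs es → All (_< s) rs → length rs ≡ length es →
    sum (fromWords rs es) ≡ s * weightedSum 1 es + (sum rs + s * ascentIndexSum 1 rs)
  sum-fromWords = sum-fromWords-from 0

  lastOr0-fromWords : ∀ rs es → length rs ≡ length es → lastOr0 (fromWords rs es) ≡ s * lastOr0 es + lastOr0 rs
  lastOr0-fromWords [] [] _ = sym (trans (+-identityʳ (s * 0)) (*-zeroʳ s))
  lastOr0-fromWords (r ∷ []) (e ∷ []) _ = refl
  lastOr0-fromWords (r ∷ r₂ ∷ rs) (e ∷ e₂ ∷ es) len = lastOr0-fromWords (r₂ ∷ rs) (e₂ ∷ es) (suc-injective len)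

  fromWords-isPartition : ∀ rs es → length rs ≡ length es → 1 ≤ lastOr0 (fromWords rs es) → IsPartition (fromWords rs es)
  fromWords-isPartition [] [] _ _ = []
  fromWords-isPartition (r ∷ []) (e ∷ []) _ 1≤last = cons z≤n 1≤last []
  fromWords-isPartition (r ∷ r₂ ∷ rs) (e ∷ e₂ ∷ es) len 1≤last
    with fromWords-isPartition (r₂ ∷ rs) (e₂ ∷ es) (suc-injective len) 1≤last
  ... | rows@(cons _ 1≤h _) = cons (m≤m+n _ _) (≤-trans 1≤h (m≤m+n _ _)) rows

  remS-residues : ∀ xs → remS s xs ≡ nonzeros (residues xs)
  remS-residues [] = refl
  remS-residues (x ∷ xs) with x % s ≡ᵇ 0
  ... | true = remS-residues xs
  ... | false = cong (x % s ∷_) (remS-residues xs)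

  rS-residues : ∀ xs → rS s xs ≡ countZeros (residues xs)
  rS-residues xs = sym (count-map (_≡ᵇ 0) (_% s) xs)

  /-suc : ∀ D → suc D / s ≡ 𝟙 (suc D % s ≡ᵇ 0) + D / s
  /-suc D with suc (D % s) <? s
  ... | yes r+1<s = begin
    suc D / s                         ≡⟨ /-congˡ split ⟩
    (s * q + suc r) / s               ≡⟨ /-+-< q r+1<s ⟩
    q                                 ≡⟨ cong (_+ q) (𝟙-no (suc D % s ≟ 0) (λ ≡0 → 0≢1+n (trans (sym ≡0) remainder))) ⟨
    𝟙 (suc D % s ≡ᵇ 0) + q           ∎
    where
    q : ℕ
    q = D / s
    r : ℕ
    r = D % s
    split : suc D ≡ s * q + suc r
    split = trans (cong suc (m≡m%n+[m/n]*n D s)) (trans (+-comm (suc r) (q * s)) (cong (_+ suc r) (*-comm q s)))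
    remainder : suc D % s ≡ suc r
    remainder = trans (cong (_% s) split) (trans (%-+-* (suc r) q) (m<n⇒m%n≡m r+1<s))
  ... | no r+1≮s = begin
    suc D / s                         ≡⟨ /-congˡ split ⟩
    (s * suc q + 0) / s               ≡⟨ /-+-< (suc q) 0<s ⟩
    suc q                             ≡⟨ cong (_+ q) (𝟙-yes (suc D % s ≟ 0) (trans (cong (_% s) split) (trans (%-+-* 0 (suc q)) (m<n⇒m%n≡m 0<s)))) ⟨
    𝟙 (suc D % s ≡ᵇ 0) + q           ∎
    where
    q : ℕ
    q = D / s
    r+1≡s : suc (D % s) ≡ s
    r+1≡s = ≤-antisym (m%n<n D s) (≮⇒≥ r+1≮s)
    split : suc D ≡ s * suc q + 0
    split = begin
      suc D                     ≡⟨ cong suc (m≡m%n+[m/n]*n D s) ⟩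
      suc (D % s) + q * s       ≡⟨ cong (_+ q * s) r+1≡s ⟩
      s + q * s                 ≡⟨ cong (s +_) (*-comm q s) ⟩
      s + s * q                 ≡⟨ *-suc s q ⟨
      s * suc q                 ≡⟨ +-identityʳ _ ⟨
      s * suc q + 0             ∎

  -- Column j of a row of length ℓ above a row of length h has leg 0 and s ∣ arm + 1.
  countedCell : ℕ → ℕ → ℕ → Bool
  countedCell ℓ h j = (h <ᵇ j) ∧ ((ℓ ∸ j + 1) % s ≡ᵇ 0)

  count-countedCell : ∀ ℓ h c lo → lo + c ≡ suc ℓ → count (countedCell ℓ h) (interval lo c) ≡ (suc ℓ ∸ (lo ⊔ suc h)) / s
  count-countedCell ℓ h zero lo lo≡ = sym (trans (/-congˡ (m≤n⇒m∸n≡0 (≤-trans (≤-reflexive (sym lo≡′)) (m≤m⊔n lo _)))) (0/n≡0 s))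
    where lo≡′ = trans (sym (+-identityʳ lo)) lo≡
  count-countedCell ℓ h (suc c) lo lo≡ with h <? lo
  ... | yes h<lo = begin
    𝟙 ((h <ᵇ lo) ∧ X) + count (countedCell ℓ h) (interval (suc lo) c)
      ≡⟨ cong₂ (λ b n → 𝟙 (b ∧ X) + n) (dec-true (h <? lo) h<lo) (count-countedCell ℓ h c (suc lo) (trans (sym (+-suc lo c)) lo≡)) ⟩
    𝟙 X + (suc ℓ ∸ (suc lo ⊔ suc h)) / s
      ≡⟨ cong (λ v → 𝟙 X + (ℓ ∸ v) / s) (m≥n⇒m⊔n≡m (<⇒≤ h<lo)) ⟩
    𝟙 X + (ℓ ∸ lo) / s
      ≡⟨ cong (λ v → 𝟙 (v % s ≡ᵇ 0) + (ℓ ∸ lo) / s) (+-comm (ℓ ∸ lo) 1) ⟩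
    𝟙 (suc (ℓ ∸ lo) % s ≡ᵇ 0) + (ℓ ∸ lo) / s
      ≡⟨ /-suc (ℓ ∸ lo) ⟨
    suc (ℓ ∸ lo) / s
      ≡⟨ /-congˡ (trans (sym (+-∸-assoc 1 lo≤ℓ)) (cong (suc ℓ ∸_) (sym (m≥n⇒m⊔n≡m h<lo)))) ⟩
    (suc ℓ ∸ (lo ⊔ suc h)) / s ∎
    where
    X : Bool
    X = (ℓ ∸ lo + 1) % s ≡ᵇ 0
    lo≤ℓ : lo ≤ ℓ
    lo≤ℓ = s≤s⁻¹ (subst (suc lo ≤_) lo≡ (subst (_≤ lo + suc c) (+-comm lo 1) (+-monoʳ-≤ lo (s≤s z≤n))))
  ... | no h≮lo = begin
    𝟙 ((h <ᵇ lo) ∧ X) + count (countedCell ℓ h) (interval (suc lo) c)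
      ≡⟨ cong₂ (λ b n → 𝟙 (b ∧ X) + n) (dec-false (h <? lo) h≮lo) (count-countedCell ℓ h c (suc lo) (trans (sym (+-suc lo c)) lo≡)) ⟩
    (suc ℓ ∸ (suc lo ⊔ suc h)) / s
      ≡⟨ cong (λ v → (suc ℓ ∸ v) / s) (trans (m≤n⇒m⊔n≡n (s≤s (≮⇒≥ h≮lo))) (sym (m≤n⇒m⊔n≡n (m≤n⇒m≤1+n (≮⇒≥ h≮lo))))) ⟩
    (suc ℓ ∸ (lo ⊔ suc h)) / s ∎
    where
    X : Bool
    X = (ℓ ∸ lo + 1) % s ≡ᵇ 0

  cS-excesses : ∀ {xs} → IsPartition xs → cS s xs ≡ sum (excesses xs)
  cS-excesses [] = refl
  cS-excesses {ℓ ∷ rest} (cons h≤ℓ _ p) = cong₂ _+_ row-count (cS-excesses p)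
    where
    h : ℕ
    h = headOr0 rest
    row-count : count (λ j → (length (filter (λ r → j ≤? r) rest) ≡ᵇ 0) ∧ ((ℓ ∸ j + 1) % s ≡ᵇ 0)) (range 1 ℓ) ≡ (ℓ ∸ h) / s
    row-count = begin
      count (λ j → (length (filter (λ r → j ≤? r) rest) ≡ᵇ 0) ∧ ((ℓ ∸ j + 1) % s ≡ᵇ 0)) (range 1 ℓ)
        ≡⟨ count-cong-∈ (range 1 ℓ) (λ {j} j∈ → cong (_∧ ((ℓ ∸ j + 1) % s ≡ᵇ 0)) (legZero (proj₁ (∈-range⁻ 1 ℓ j∈)) p)) ⟩
      count (countedCell ℓ h) (range 1 ℓ)
        ≡⟨ cong (count (countedCell ℓ h)) (range≡interval 1 ℓ) ⟩
      count (countedCell ℓ h) (interval 1 ℓ)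
        ≡⟨ count-countedCell ℓ h ℓ 1 refl ⟩
      (ℓ ∸ h) / s ∎

nonzeroPositions : ℕ → List ℕ → List ℕ
nonzeroPositions i [] = []
nonzeroPositions i (r ∷ rs) = if r ≡ᵇ 0 then nonzeroPositions (suc i) rs else i ∷ nonzeroPositions (suc i) rs

-- The word of length c, with positions numbered from i, carrying the letters
-- of ρ at the positions γ and 0 elsewhere.
scatter : ℕ → List ℕ → List ℕ → ℕ → List ℕ
scatter i ρ γ zero = []
scatter i ρ [] (suc c) = 0 ∷ scatter (suc i) ρ [] c
scatter i ρ (g ∷ γ) (suc c) =
  if g ≡ᵇ i then headOr0 ρ ∷ scatter (suc i) (drop 1 ρ) γ c else 0 ∷ scatter (suc i) ρ (g ∷ γ) c

data IncreasingFrom : ℕ → List ℕ → Set where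
  [] : ∀ {i} → IncreasingFrom i []
  _∷_ : ∀ {i g γ} → i ≤ g → IncreasingFrom (suc g) γ → IncreasingFrom i (g ∷ γ)

IncreasingFrom-weaken : ∀ {i j γ} → i ≤ j → IncreasingFrom j γ → IncreasingFrom i γ
IncreasingFrom-weaken i≤j [] = []
IncreasingFrom-weaken i≤j (j≤g ∷ inc) = ≤-trans i≤j j≤g ∷ inc

IncreasingFrom-≤-last : ∀ {i γ} → IncreasingFrom i γ → All (_≤ lastOr0 γ) γ
IncreasingFrom-≤-last [] = []
IncreasingFrom-≤-last {γ = _ ∷ []} (_ ∷ []) = ≤-refl ∷ []
IncreasingFrom-≤-last {γ = _ ∷ _ ∷ _} (_ ∷ inc@(g<g₂ ∷ _)) with IncreasingFrom-≤-last inc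
... | rest@(g₂≤last ∷ _) = ≤-trans (<⇒≤ g<g₂) g₂≤last ∷ rest

nonzeroPositions-increasing : ∀ i w → IncreasingFrom i (nonzeroPositions i w)
nonzeroPositions-increasing i [] = []
nonzeroPositions-increasing i (r ∷ w) with r ≡ᵇ 0
... | true = IncreasingFrom-weaken (n≤1+n i) (nonzeroPositions-increasing (suc i) w)
... | false = ≤-refl ∷ nonzeroPositions-increasing (suc i) w

length-nonzeroPositions : ∀ i w → length (nonzeroPositions i w) ≡ length (nonzeros w)
length-nonzeroPositions i [] = refl
length-nonzeroPositions i (r ∷ w) with r ≡ᵇ 0
... | true = length-nonzeroPositions (suc i) w
... | false = cong suc (length-nonzeroPositions (suc i) w)

scatter-skip : ∀ {i ρ γ c} → IncreasingFrom (suc i) γ → scatter i ρ γ (suc c) ≡ 0 ∷ scatter (suc i) ρ γ c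
scatter-skip [] = refl
scatter-skip {i} {γ = g ∷ _} (i<g ∷ _) rewrite dec-false (g ≟ i) (>⇒≢ i<g) = refl

scatter-hit : ∀ {i r ρ γ c} → scatter i (r ∷ ρ) (i ∷ γ) (suc c) ≡ r ∷ scatter (suc i) ρ γ c
scatter-hit {i} rewrite dec-true (i ≟ i) refl = refl

scatter-nonzeros : ∀ i w → scatter i (nonzeros w) (nonzeroPositions i w) (length w) ≡ w
scatter-nonzeros i [] = refl
scatter-nonzeros i (r ∷ w) with r ≟ 0
... | yes refl = trans (scatter-skip (nonzeroPositions-increasing (suc i) w)) (cong (0 ∷_) (scatter-nonzeros (suc i) w))
... | no r≢0 rewrite dec-false (r ≟ 0) r≢0 =
  trans (scatter-hit {i} {r} {nonzeros w} {nonzeroPositions (suc i) w} {length w}) (cong (r ∷_) (scatter-nonzeros (suc i) w))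

record Placement (i : ℕ) (ρ γ : List ℕ) (c : ℕ) : Set where
  field
    increasing : IncreasingFrom i γ
    bounded : All (_< i + c) γ
    length≡ : length ρ ≡ length γ
    positive : All (1 ≤_) ρ

open Placement

private
  shift-bound : ∀ {i c} γ → All (_< i + suc c) γ → All (_< suc i + c) γ
  shift-bound {i} {c} γ = All.map (λ {x} x< → subst (x <_) (+-suc i c) x<)

Placement-empty : ∀ {i c} → Placement i [] [] c
Placement-empty = record { increasing = [] ; bounded = [] ; length≡ = refl ; positive = [] }

Placement-skip : ∀ {i ρ g γ c} → Placement i ρ (g ∷ γ) (suc c) → g ≢ i → Placement (suc i) ρ (g ∷ γ) c
Placement-skip {i} {g = g} {γ} {c} p g≢i with increasing p
... | i≤g ∷ inc = record
  { increasing = ≤∧≢⇒< i≤g (≢-sym g≢i) ∷ inc ; bounded = shift-bound (g ∷ γ) (bounded p)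
  ; length≡ = length≡ p ; positive = positive p }

Placement-hit : ∀ {i r ρ γ c} → Placement i (r ∷ ρ) (i ∷ γ) (suc c) → Placement (suc i) ρ γ c
Placement-hit {i} {γ = γ} p with increasing p | bounded p | positive p
... | _ ∷ inc | _ ∷ γ< | _ ∷ pos = record
  { increasing = inc ; bounded = shift-bound γ γ< ; length≡ = suc-injective (length≡ p) ; positive = pos }

Placement-window : ∀ {i ρ g γ c} → Placement i ρ (g ∷ γ) c → 1 ≤ c
Placement-window {i} {c = zero} p with increasing p | bounded p
... | i≤g ∷ _ | g< ∷ _ = contradiction (subst (_ <_) (+-identityʳ i) g<) (≤⇒≯ i≤g)
Placement-window {c = suc c} _ = s≤s z≤n

length-scatter : ∀ i ρ γ c → length (scatter i ρ γ c) ≡ c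
length-scatter i ρ γ zero = refl
length-scatter i ρ [] (suc c) = cong suc (length-scatter (suc i) ρ [] c)
length-scatter i ρ (g ∷ γ) (suc c) with g ≡ᵇ i
... | true = cong suc (length-scatter (suc i) (drop 1 ρ) γ c)
... | false = cong suc (length-scatter (suc i) ρ (g ∷ γ) c)

scatter-inverse : ∀ {i ρ γ c} → Placement i ρ γ c →
  nonzeroPositions i (scatter i ρ γ c) ≡ γ × nonzeros (scatter i ρ γ c) ≡ ρ
scatter-inverse {i} {[]} {[]} {zero} p = refl , refl
scatter-inverse {i} {[]} {[]} {suc c} p = scatter-inverse {suc i} {[]} {[]} {c} Placement-empty
scatter-inverse {i} {ρ} {g ∷ γ} {zero} p = contradiction (Placement-window p) λ ()
scatter-inverse {i} {r ∷ ρ} {g ∷ γ} {suc c} p with g ≟ i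
... | yes refl with positive p
...   | 1≤r ∷ _ rewrite dec-true (g ≟ g) refl | dec-false (r ≟ 0) (>⇒≢ 1≤r) =
  let (positions , letters) = scatter-inverse (Placement-hit p) in cong (g ∷_) positions , cong (r ∷_) letters
scatter-inverse {i} {r ∷ ρ} {g ∷ γ} {suc c} p | no g≢i rewrite dec-false (g ≟ i) g≢i =
  scatter-inverse (Placement-skip p g≢i)
scatter-inverse {ρ = []} {_ ∷ _} p = contradiction (length≡ p) λ ()
scatter-inverse {ρ = _ ∷ _} {[]} p = contradiction (length≡ p) λ ()

scatter-< : ∀ {s} → 0 < s → ∀ i ρ γ c → All (_< s) ρ → All (_< s) (scatter i ρ γ c)
scatter-< 0<s i ρ γ zero _ = []
scatter-< 0<s i ρ [] (suc c) ρ<s = 0<s ∷ scatter-< 0<s (suc i) ρ [] c ρ<s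
scatter-< {s} 0<s i ρ (g ∷ γ) (suc c) ρ<s with g ≡ᵇ i
... | true = head< ρ ρ<s ∷ scatter-< 0<s (suc i) (drop 1 ρ) γ c (tail< ρ ρ<s)
  where
  head< : ∀ ρ → All (_< s) ρ → headOr0 ρ < s
  head< [] _ = 0<s
  head< (_ ∷ _) (r< ∷ _) = r<
  tail< : ∀ ρ → All (_< s) ρ → All (_< s) (drop 1 ρ)
  tail< [] _ = []
  tail< (_ ∷ _) (_ ∷ ρ<) = ρ<
... | false = 0<s ∷ scatter-< 0<s (suc i) ρ (g ∷ γ) c ρ<s

sum-nonzeros : ∀ w → sum (nonzeros w) ≡ sum w
sum-nonzeros [] = refl
sum-nonzeros (r ∷ w) with r ≟ 0
... | yes refl = sum-nonzeros w
... | no r≢0 rewrite dec-false (r ≟ 0) r≢0 = cong (r +_) (sum-nonzeros w)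

countZeros+length-nonzeros : ∀ w → countZeros w + length (nonzeros w) ≡ length w
countZeros+length-nonzeros [] = refl
countZeros+length-nonzeros (r ∷ w) with r ≡ᵇ 0
... | true = cong suc (countZeros+length-nonzeros w)
... | false = trans (+-suc (countZeros w) _) (cong suc (countZeros+length-nonzeros w))

nonzeros-positive : ∀ w → All (1 ≤_) (nonzeros w)
nonzeros-positive [] = []
nonzeros-positive (r ∷ w) with r ≟ 0
... | yes refl = nonzeros-positive w
... | no r≢0 rewrite dec-false (r ≟ 0) r≢0 = n≢0⇒n>0 r≢0 ∷ nonzeros-positive w

nonzeroPositions-< : ∀ i w → All (_< i + length w) (nonzeroPositions i w)
nonzeroPositions-< i [] = []
nonzeroPositions-< i (r ∷ w) with r ≡ᵇ 0
... | true = All.map (λ {x} x< → subst (x <_) (sym (+-suc i (length w))) x<) (nonzeroPositions-< (suc i) w)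
... | false = subst (i <_) (sym (+-suc i (length w))) (s≤s (m≤m+n i _))
            ∷ All.map (λ {x} x< → subst (x <_) (sym (+-suc i (length w))) x<) (nonzeroPositions-< (suc i) w)

lastOr0-nonzeroPositions : ∀ i w → 1 ≤ lastOr0 w → suc (lastOr0 (nonzeroPositions i w)) ≡ i + length w
lastOr0-nonzeroPositions i (r ∷ []) 1≤r rewrite dec-false (r ≟ 0) (>⇒≢ 1≤r) = +-comm 1 i
lastOr0-nonzeroPositions i (r ∷ w@(_ ∷ _)) 1≤last with lastOr0-nonzeroPositions (suc i) w 1≤last
... | ih with r ≡ᵇ 0
... | true = trans ih (sym (+-suc i _))
... | false = trans (cong suc (lastOr0-∷ i (nonzeroPositions (suc i) w) nonempty)) (trans ih (sym (+-suc i _)))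
  where
  nonempty : 1 ≤ length (nonzeroPositions (suc i) w)
  nonempty = lastOr0-positive⇒nonempty {nonzeroPositions (suc i) w} (subst (1 ≤_) (sym (suc-injective ih)) (≤-trans (s≤s z≤n) (m≤n+m _ i)))

dTailExp : ℕ → ℕ → List ℕ → List ℕ → ℕ
dTailExp ρp γp ρ γ = sum (zipWith (λ d g → d * (g ∸ 1)) (dTail ρp γp ρ γ) γ)

-- The letter x at position j of a scattered word: either the letter ρp placed
-- there (γp = j), or a 0 after the last placement γp.
data LetterAt (j : ℕ) : ℕ → ℕ → ℕ → Set where
  placed : ∀ {ρp} → LetterAt j ρp ρp j
  blank : ∀ {ρp γp} → γp < j → LetterAt j 0 ρp γp

LetterAt-≤ : ∀ {j x ρp γp} → LetterAt j x ρp γp → γp ≤ j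
LetterAt-≤ placed = ≤-refl
LetterAt-≤ (blank γp<j) = <⇒≤ γp<j

ascent-LetterAt : ∀ {j x ρp γp r} → LetterAt j x ρp γp → 1 ≤ r →
  𝟙 (x <ᵇ r) ≡ (if (r ≤ᵇ ρp) ∧ (suc j ≡ᵇ suc γp) then 0 else 1)
ascent-LetterAt {j} {ρp = ρp} {r = r} placed _ rewrite dec-true (j ≟ j) refl | ∧-identityʳ (r ≤ᵇ ρp) with r ≤? ρp
... | yes r≤ρp rewrite dec-true (r ≤? ρp) r≤ρp = 𝟙-no (ρp <? r) (≤⇒≯ r≤ρp)
... | no r≰ρp rewrite dec-false (r ≤? ρp) r≰ρp = 𝟙-yes (ρp <? r) (≰⇒> r≰ρp)
ascent-LetterAt {j} {r = suc r} (blank {ρp} {γp} γp<j) _ rewrite dec-false (j ≟ γp) (>⇒≢ γp<j) | ∧-zeroʳ (r <ᵇ ρp) = refl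

ascentIndexSum-scatter-from : ∀ c j {x ρp γp ρ γ} → Placement (suc j) ρ γ c → LetterAt j x ρp γp →
  ascentIndexSum j (x ∷ scatter (suc j) ρ γ c) ≡ dTailExp ρp γp ρ γ
ascentIndexSum-scatter-from zero j {ρ = []} {[]} _ _ = refl
ascentIndexSum-scatter-from zero j {γ = _ ∷ _} p _ = contradiction (Placement-window p) λ ()
ascentIndexSum-scatter-from (suc c) j {ρp = ρp} {γp} {[]} {[]} _ x-at =
  ascentIndexSum-scatter-from c (suc j) (Placement-empty {c = c}) (blank {ρp = ρp} {γp} (s≤s (LetterAt-≤ x-at)))
ascentIndexSum-scatter-from (suc c) j {x} {ρp} {γp} {r ∷ ρ} {g ∷ γ} p x-at with g ≟ suc j
... | yes refl = begin
  ascentIndexSum j (x ∷ scatter g (r ∷ ρ) (g ∷ γ) (suc c))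
    ≡⟨ cong (λ w → ascentIndexSum j (x ∷ w)) (scatter-hit {g} {r} {ρ} {γ} {c}) ⟩
  𝟙 (x <ᵇ r) * j + ascentIndexSum g (r ∷ scatter (suc g) ρ γ c)
    ≡⟨ cong₂ (λ a b → a * j + b) (ascent-LetterAt x-at (All.head (positive p))) (ascentIndexSum-scatter-from c g (Placement-hit p) placed) ⟩
  dTailExp ρp γp (r ∷ ρ) (g ∷ γ) ∎
... | no g≢1+j = trans (cong (λ w → ascentIndexSum j (x ∷ w)) (scatter-skip {ρ = r ∷ ρ} {c = c} (increasing p′)))
  (ascentIndexSum-scatter-from c (suc j) p′ (blank (s≤s (LetterAt-≤ x-at))))
  where
  p′ : Placement (suc (suc j)) (r ∷ ρ) (g ∷ γ) c
  p′ = Placement-skip p g≢1+j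
ascentIndexSum-scatter-from _ j {ρ = []} {_ ∷ _} p _ = contradiction (length≡ p) λ ()
ascentIndexSum-scatter-from _ j {ρ = _ ∷ _} {[]} p _ = contradiction (length≡ p) λ ()

ascentIndexSum-scatter : ∀ {ρ γ c} → Placement 1 ρ γ c → ascentIndexSum 1 (scatter 1 ρ γ c) ≡ dExp ρ γ
ascentIndexSum-scatter {ρ} {γ} {c} p = begin
  ascentIndexSum 1 w                        ≡⟨ cong (_+ ascentIndexSum 1 w) (*-zeroʳ (𝟙 (0 <ᵇ headOr0 w))) ⟨
  ascentIndexSum 0 (0 ∷ w)                  ≡⟨ ascentIndexSum-scatter-from c 0 p placed ⟩
  dTailExp 0 0 ρ γ                          ≡⟨ first-d ρ γ (positive p) ⟩
  dExp ρ γ                                  ∎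
  where
  w : List ℕ
  w = scatter 1 ρ γ c
  first-d : ∀ ρ γ → All (1 ≤_) ρ → dTailExp 0 0 ρ γ ≡ dExp ρ γ
  first-d [] γ _ = refl
  first-d (_ ∷ _) [] _ = refl
  first-d (suc _ ∷ _) (_ ∷ _) _ = refl
  first-d (zero ∷ _) (_ ∷ _) (() ∷ _)

lastOr0-scatter : ∀ {i ρ γ c} → Placement i ρ γ c → 1 ≤ length γ → suc (lastOr0 γ) ≡ i + c →
  lastOr0 (scatter i ρ γ c) ≡ lastOr0 ρ
lastOr0-scatter-hit : ∀ {g r ρ γ c} → Placement g (r ∷ ρ) (g ∷ γ) (suc c) → suc (lastOr0 (g ∷ γ)) ≡ g + suc c →
  lastOr0 (r ∷ scatter (suc g) ρ γ c) ≡ lastOr0 (r ∷ ρ)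

lastOr0-scatter {γ = []} _ () _
lastOr0-scatter {γ = _ ∷ _} {zero} p _ _ = contradiction (Placement-window p) λ ()
lastOr0-scatter {ρ = []} {_ ∷ _} p _ _ = contradiction (length≡ p) λ ()
lastOr0-scatter {i} {r ∷ ρ} {g ∷ γ} {suc c} p _ last≡ with g ≟ i
... | yes refl = trans (cong lastOr0 (scatter-hit {g} {r} {ρ} {γ} {c})) (lastOr0-scatter-hit p last≡)
... | no g≢i = begin
  lastOr0 (scatter i (r ∷ ρ) (g ∷ γ) (suc c))   ≡⟨ cong lastOr0 (scatter-skip {ρ = r ∷ ρ} {c = c} (increasing p′)) ⟩
  lastOr0 (0 ∷ scatter (suc i) (r ∷ ρ) (g ∷ γ) c) ≡⟨ lastOr0-∷ 0 (scatter (suc i) (r ∷ ρ) (g ∷ γ) c) (subst (1 ≤_) (sym (length-scatter (suc i) (r ∷ ρ) (g ∷ γ) c)) (Placement-window p′)) ⟩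
  lastOr0 (scatter (suc i) (r ∷ ρ) (g ∷ γ) c)     ≡⟨ lastOr0-scatter p′ (s≤s z≤n) (trans last≡ (+-suc i c)) ⟩
  lastOr0 (r ∷ ρ)                                 ∎
  where
  p′ : Placement (suc i) (r ∷ ρ) (g ∷ γ) c
  p′ = Placement-skip p g≢i

lastOr0-scatter-hit {g} {r} {[]} {[]} {c} p last≡ = cong (λ c → lastOr0 (r ∷ scatter (suc g) [] [] c)) c≡0
  where
  c≡0 : c ≡ 0
  c≡0 = sym (+-cancelˡ-≡ g 0 c (trans (+-identityʳ g) (suc-injective (trans last≡ (+-suc g c)))))
lastOr0-scatter-hit {g} {r} {r₂ ∷ ρ} {g₂ ∷ γ} {c} p last≡ = begin
  lastOr0 (r ∷ scatter (suc g) (r₂ ∷ ρ) (g₂ ∷ γ) c) ≡⟨ lastOr0-∷ r (scatter (suc g) (r₂ ∷ ρ) (g₂ ∷ γ) c) (subst (1 ≤_) (sym (length-scatter (suc g) (r₂ ∷ ρ) (g₂ ∷ γ) c)) (Placement-window p′)) ⟩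
  lastOr0 (scatter (suc g) (r₂ ∷ ρ) (g₂ ∷ γ) c)     ≡⟨ lastOr0-scatter p′ (s≤s z≤n) (trans last≡ (+-suc g c)) ⟩
  lastOr0 (r₂ ∷ ρ)                                  ∎
  where
  p′ : Placement (suc g) (r₂ ∷ ρ) (g₂ ∷ γ) c
  p′ = Placement-hit p
lastOr0-scatter-hit {ρ = []} {_ ∷ _} p _ = contradiction (suc-injective (length≡ p)) λ ()
lastOr0-scatter-hit {ρ = _ ∷ _} {[]} p _ = contradiction (suc-injective (length≡ p)) λ ()

lastOr0-≤-dTailExp : ∀ ρp γp ρ γ → length ρ ≡ length γ → lastOr0 (γp ∷ γ) ≤ dTailExp ρp γp ρ γ + γp + length γ
lastOr0-≤-dTailExp ρp γp [] [] _ = ≤-reflexive (sym (+-identityʳ γp))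
lastOr0-≤-dTailExp ρp γp (r ∷ ρ) (g ∷ γ) length≡ =
  ≤-trans (lastOr0-≤-dTailExp r g ρ γ (suc-injective length≡))
    (≤-trans (+-monoˡ-≤ (length γ) (+-monoʳ-≤ D (g≤ (g ≟ suc γp))))
             (≤-reflexive (regroup D (d * (g ∸ 1)) γp (length γ))))
  where
  D : ℕ
  D = dTailExp r g ρ γ
  d : ℕ
  d = if (r ≤ᵇ ρp) ∧ (g ≡ᵇ suc γp) then 0 else 1
  -- d = 0 only when g = γp + 1
  g≤ : Dec (g ≡ suc γp) → g ≤ d * (g ∸ 1) + suc γp
  g≤ (yes refl) = m≤n+m (suc γp) _
  g≤ (no g≢) rewrite dec-false (g ≟ suc γp) g≢ | ∧-zeroʳ (r ≤ᵇ ρp) =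
    ≤-trans (m≤n+m∸n g 1) (≤-trans (m≤m+n (suc (g ∸ 1)) γp) (≤-reflexive (shuffle (g ∸ 1) γp)))
    where
    shuffle : ∀ x p → suc x + p ≡ 1 * x + suc p
    shuffle = solve-∀
  regroup : ∀ D x p L → D + (x + suc p) + L ≡ x + D + p + suc L
  regroup = solve-∀
lastOr0-≤-dTailExp ρp γp [] (_ ∷ _) ()
lastOr0-≤-dTailExp ρp γp (_ ∷ _) [] ()

lastOr0-≤-dExp : ∀ {ρ γ} → IncreasingFrom 1 γ → length ρ ≡ length γ → lastOr0 γ ≤ dExp ρ γ + length ρ
lastOr0-≤-dExp {[]} {[]} _ _ = z≤n
lastOr0-≤-dExp {r ∷ ρ} {g ∷ γ} (1≤g ∷ _) length≡ =
  ≤-trans (lastOr0-≤-dTailExp r g ρ γ (suc-injective length≡)) (≤-reflexive (begin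
    D + g + length γ                         ≡⟨ cong (λ x → D + x + length γ) (sym (m∸n+n≡m 1≤g)) ⟩
    D + (g ∸ 1 + 1) + length γ               ≡⟨ regroup D (g ∸ 1) (length γ) ⟩
    1 * (g ∸ 1) + D + suc (length γ)         ≡⟨ cong (λ L → 1 * (g ∸ 1) + D + suc L) (suc-injective length≡) ⟨
    dExp (r ∷ ρ) (g ∷ γ) + length (r ∷ ρ)    ∎))
  where
  D : ℕ
  D = dTailExp r g ρ γ
  regroup : ∀ D x L → D + (x + 1) + L ≡ 1 * x + D + suc L
  regroup = solve-∀

-- Excess words

-- excessWord k js ℓ is the word of length ℓ whose last positive letter sits at
-- position k, its first k letters being js with the k-th raised by one (so js
-- ranges over the exponent vectors of 1/(CQ;Q)_k); k = 0 gives the zero word.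
excessWord : ℕ → List ℕ → ℕ → List ℕ
excessWord zero js ℓ = replicate ℓ 0
excessWord (suc k) js zero = []
excessWord (suc zero) js (suc ℓ) = suc (headOr0 js) ∷ replicate ℓ 0
excessWord (suc (suc k)) js (suc ℓ) = headOr0 js ∷ excessWord (suc k) (drop 1 js) ℓ

splitStep : ℕ → ℕ × List ℕ → ℕ × List ℕ
splitStep e (zero , _) = if e ≡ᵇ 0 then (0 , []) else (1 , (e ∸ 1) ∷ [])
splitStep e (suc k , js) = (suc (suc k) , e ∷ js)

splitExcess : List ℕ → ℕ × List ℕ
splitExcess [] = (0 , [])
splitExcess (e ∷ es) = splitStep e (splitExcess es)

excessWord-splitExcess : ∀ ew → excessWord (proj₁ (splitExcess ew)) (proj₂ (splitExcess ew)) (length ew) ≡ ew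
excessWord-splitExcess [] = refl
excessWord-splitExcess (e ∷ es) with splitExcess es | excessWord-splitExcess es
... | (suc k , js) | ih = cong (e ∷_) ih
... | (zero , js) | ih with e ≟ 0
...   | yes refl = cong (0 ∷_) ih
...   | no e≢0 rewrite dec-false (e ≟ 0) e≢0 = cong₂ _∷_ (m+[n∸m]≡n (n≢0⇒n>0 e≢0)) ih

splitExcess-zeros : ∀ ℓ → splitExcess (replicate ℓ 0) ≡ (0 , [])
splitExcess-zeros zero = refl
splitExcess-zeros (suc ℓ) rewrite splitExcess-zeros ℓ = refl

splitExcess-excessWord : ∀ k js ℓ → k ≤ ℓ → length js ≡ k → splitExcess (excessWord k js ℓ) ≡ (k , js)
splitExcess-excessWord zero [] ℓ _ _ = splitExcess-zeros ℓ
splitExcess-excessWord (suc zero) (j ∷ []) (suc ℓ) _ _ rewrite splitExcess-zeros ℓ = refl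
splitExcess-excessWord (suc (suc k)) (j ∷ js) (suc ℓ) (s≤s k≤ℓ) len
  rewrite splitExcess-excessWord (suc k) js ℓ k≤ℓ (suc-injective len) = refl

length-excessWord : ∀ k js ℓ → k ≤ ℓ → length (excessWord k js ℓ) ≡ ℓ
length-excessWord zero js ℓ _ = length-replicate ℓ
length-excessWord (suc zero) js (suc ℓ) _ = cong suc (length-replicate ℓ)
length-excessWord (suc (suc k)) js (suc ℓ) (s≤s k≤ℓ) = cong suc (length-excessWord (suc k) (drop 1 js) ℓ k≤ℓ)

weightedSum-zeros : ∀ i ℓ → weightedSum i (replicate ℓ 0) ≡ 0
weightedSum-zeros i zero = refl
weightedSum-zeros i (suc ℓ) = trans (cong (_+ weightedSum (suc i) (replicate ℓ 0)) (*-zeroʳ i)) (weightedSum-zeros (suc i) ℓ)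

weightedSum-excessWord-suc : ∀ i k js ℓ → suc k ≤ ℓ → length js ≡ suc k →
  weightedSum i (excessWord (suc k) js ℓ) ≡ i + k + weightedSum i js
weightedSum-excessWord-suc i zero (j ∷ []) (suc ℓ) _ _ =
  trans (cong (i * suc j +_) (weightedSum-zeros (suc i) ℓ)) (regroup i j)
  where
  regroup : ∀ i j → i * suc j + 0 ≡ i + 0 + (i * j + 0)
  regroup = solve-∀
weightedSum-excessWord-suc i (suc k) (j ∷ js) (suc ℓ) (s≤s k≤ℓ) len =
  trans (cong (i * j +_) (weightedSum-excessWord-suc (suc i) k js ℓ k≤ℓ (suc-injective len))) (regroup i j k (weightedSum (suc i) js))
  where
  regroup : ∀ i j k w → i * j + (suc i + k + w) ≡ i + suc k + (i * j + w)
  regroup = solve-∀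

weightedSum-excessWord : ∀ k js ℓ → k ≤ ℓ → length js ≡ k → weightedSum 1 (excessWord k js ℓ) ≡ k + weightedSum 1 js
weightedSum-excessWord zero [] ℓ _ _ = weightedSum-zeros 1 ℓ
weightedSum-excessWord (suc k) js ℓ k≤ℓ len = weightedSum-excessWord-suc 1 k js ℓ k≤ℓ len

sum-zeros : ∀ ℓ → sum (replicate ℓ 0) ≡ 0
sum-zeros zero = refl
sum-zeros (suc ℓ) = sum-zeros ℓ

sum-excessWord : ∀ k js ℓ → suc k ≤ ℓ → length js ≡ suc k → sum (excessWord (suc k) js ℓ) ≡ suc (sum js)
sum-excessWord zero (j ∷ []) (suc ℓ) _ _ = cong (λ t → suc (j + t)) (sum-zeros ℓ)
sum-excessWord (suc k) (j ∷ js) (suc ℓ) (s≤s k≤ℓ) len = trans (cong (j +_) (sum-excessWord k js ℓ k≤ℓ (suc-injective len))) (+-suc j (sum js))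

lastOr0-excessWord : ∀ k js → length js ≡ suc k → lastOr0 (excessWord (suc k) js (suc k)) ≡ suc (lastOr0 js)
lastOr0-excessWord zero (j ∷ []) _ = refl
lastOr0-excessWord (suc k) (j ∷ js@(_ ∷ _)) len =
  trans (lastOr0-∷ j w (subst (1 ≤_) (sym (length-excessWord (suc k) js (suc k) ≤-refl)) (s≤s z≤n)))
        (lastOr0-excessWord k js (suc-injective len))
  where w = excessWord (suc k) js (suc k)

splitExcess-≤ : ∀ ew → proj₁ (splitExcess ew) ≤ length ew
splitExcess-≤ [] = z≤n
splitExcess-≤ (e ∷ es) with splitExcess es | splitExcess-≤ es
... | (zero , _) | _ with e ≡ᵇ 0
...   | true = z≤n
...   | false = s≤s z≤n
splitExcess-≤ (e ∷ es) | (suc k , _) | k≤ = s≤s k≤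

length-splitExcess : ∀ ew → length (proj₂ (splitExcess ew)) ≡ proj₁ (splitExcess ew)
length-splitExcess [] = refl
length-splitExcess (e ∷ es) with splitExcess es | length-splitExcess es
... | (zero , _) | _ with e ≡ᵇ 0
...   | true = refl
...   | false = refl
length-splitExcess (e ∷ es) | (suc k , _) | len = cong suc len

splitExcess-last : ∀ ew → 1 ≤ lastOr0 ew → proj₁ (splitExcess ew) ≡ length ew
splitExcess-last (e ∷ []) 1≤e rewrite dec-false (e ≟ 0) (>⇒≢ 1≤e) = refl
splitExcess-last (e ∷ e₂ ∷ es) 1≤last with splitExcess (e₂ ∷ es) | splitExcess-last (e₂ ∷ es) 1≤last
... | (suc k , js) | ih = cong suc ih

_≟ₗ_ : DecidableEquality (List ℕ)
_≟ₗ_ = ≡-dec _≟_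

mult-∷-concatMap : ∀ (F : ℕ → List (List ℕ)) xs x t →
  mult _≟ₗ_ (x ∷ t) (concatMap (λ x → map (x ∷_) (F x)) xs) ≡ mult _≟_ x xs * mult _≟ₗ_ t (F x)
mult-∷-concatMap = mult-concatMap _≟_ _≟ₗ_ _≟ₗ_ _∷_ ∷-injective

∈-parts⁻ : ∀ f n mx {l} → l ∈ parts f n mx → IsPartition l × sum l ≡ n × headOr0 l ≤ mx
∈-parts⁻ f zero mx (here refl) = [] , refl , z≤n
∈-parts⁻ (suc f) (suc n) mx l∈ with ∈-concatMap-map⁻ _∷_ (λ p → parts f (suc n ∸ p) p) (range 1 (suc n ⊓ mx)) l∈
... | p , xs , p∈ , xs∈ , refl with ∈-parts⁻ f (suc n ∸ p) p xs∈ | ∈-range⁻ 1 (suc n ⊓ mx) p∈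
... | xs-partition , sum-xs , head≤p | 1≤p , p≤ =
  cons head≤p 1≤p xs-partition , trans (cong (p +_) sum-xs) (m+[n∸m]≡n (≤-trans p≤ (m⊓n≤m _ _))) , ≤-trans p≤ (m⊓n≤n _ _)

mult-parts : ∀ f n mx {l} → IsPartition l → sum l ≡ n → headOr0 l ≤ mx → n ≤ f → mult _≟ₗ_ l (parts f n mx) ≡ 1
mult-parts f zero mx [] _ _ _ = refl
mult-parts f zero mx (cons _ 1≤x _) sum≡0 _ _ = contradiction (≤-trans 1≤x (m≤m+n _ _)) (λ 1≤sum → <⇒≢ 1≤sum (sym sum≡0))
mult-parts zero (suc n) mx {_ ∷ _} _ _ _ ()
mult-parts (suc f) (suc n) mx {x ∷ xs} (cons head≤x 1≤x p) sum≡ x≤mx (s≤s n≤f) = begin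
  mult _≟ₗ_ (x ∷ xs) (parts (suc f) (suc n) mx)
    ≡⟨ mult-∷-concatMap (λ p → parts f (suc n ∸ p) p) (range 1 (suc n ⊓ mx)) x xs ⟩
  mult _≟_ x (range 1 (suc n ⊓ mx)) * mult _≟ₗ_ xs (parts f (suc n ∸ x) x)
    ≡⟨ cong₂ _*_ (mult-range 1 (suc n ⊓ mx) 1≤x (⊓-glb x≤1+n x≤mx)) (mult-parts f (suc n ∸ x) x p sum-xs head≤x rest≤f) ⟩
  1 ∎
  where
  x≤1+n : x ≤ suc n
  x≤1+n = subst (x ≤_) sum≡ (m≤m+n x (sum xs))
  sum-xs : sum xs ≡ suc n ∸ x
  sum-xs = trans (sym (m+n∸m≡n x (sum xs))) (cong (_∸ x) sum≡)
  rest≤f : suc n ∸ x ≤ f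
  rest≤f = ≤-trans (∸-monoʳ-≤ (suc n) 1≤x) n≤f

∈-incSeqs⁻ : ∀ m lo hi {γ} → γ ∈ incSeqs m lo hi → IncreasingFrom lo γ × All (_≤ hi) γ × length γ ≡ m
∈-incSeqs⁻ zero lo hi (here refl) = [] , [] , refl
∈-incSeqs⁻ (suc m) lo hi γ∈ with ∈-concatMap-map⁻ _∷_ (λ x → incSeqs m (suc x) hi) (range lo hi) γ∈
... | x , γ , x∈ , γ∈′ , refl with ∈-incSeqs⁻ m (suc x) hi γ∈′ | ∈-range⁻ lo hi x∈
... | increasing , γ≤hi , length≡ | lo≤x , x≤hi = lo≤x ∷ increasing , x≤hi ∷ γ≤hi , cong suc length≡

mult-incSeqs : ∀ m lo hi {γ} → IncreasingFrom lo γ → All (_≤ hi) γ → length γ ≡ m → mult _≟ₗ_ γ (incSeqs m lo hi) ≡ 1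
mult-incSeqs zero lo hi [] [] refl = refl
mult-incSeqs (suc m) lo hi {x ∷ γ} (lo≤x ∷ increasing) (x≤hi ∷ γ≤hi) length≡ = begin
  mult _≟ₗ_ (x ∷ γ) (incSeqs (suc m) lo hi)
    ≡⟨ mult-∷-concatMap (λ x → incSeqs m (suc x) hi) (range lo hi) x γ ⟩
  mult _≟_ x (range lo hi) * mult _≟ₗ_ γ (incSeqs m (suc x) hi)
    ≡⟨ cong₂ _*_ (mult-range lo hi lo≤x x≤hi) (mult-incSeqs m (suc x) hi increasing γ≤hi (suc-injective length≡)) ⟩
  1 ∎

mult-boundedVectors : ∀ is b {js} → length js ≡ length is → sum js ≤ b → mult _≟ₗ_ js (boundedVectors is b) ≡ 1
mult-boundedVectors [] b {[]} _ _ = refl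
mult-boundedVectors (i ∷ is) b {j ∷ js} length≡ sum≤ = begin
  mult _≟ₗ_ (j ∷ js) (boundedVectors (i ∷ is) b)
    ≡⟨ mult-∷-concatMap (λ j → boundedVectors is (b ∸ j)) (range 0 b) j js ⟩
  mult _≟_ j (range 0 b) * mult _≟ₗ_ js (boundedVectors is (b ∸ j))
    ≡⟨ cong₂ _*_ (mult-range 0 b z≤n (≤-trans (m≤m+n j (sum js)) sum≤))
                 (mult-boundedVectors is (b ∸ j) (suc-injective length≡) (subst (_≤ b ∸ j) (m+n∸m≡n j (sum js)) (∸-monoˡ-≤ j sum≤))) ⟩
  1 ∎

-- The bijection

module Bijection (s : ℕ) .{{_ : NonZero s}} (ρ : List ℕ) (ρ-nonempty : 1 ≤ length ρ)
                 (ρ-residues : All (λ r → 1 ≤ r × r ≤ s ∸ 1) ρ) where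

  open Encoding s
  open RHSExpansion s ρ

  ρ-positive : All (1 ≤_) ρ
  ρ-positive = All.map proj₁ ρ-residues

  ρ-< : All (_< s) ρ
  ρ-< = All.map (λ (_ , r≤s-1) → m≤pred[n]⇒suc[m]≤n r≤s-1) ρ-residues

  toTerm : List ℕ → Term
  toTerm xs = nonzeroPositions 1 (residues xs) , splitExcess (excesses xs)

  fromTerm : Term → List ℕ
  fromTerm (γ , k , js) = fromWords (scatter 1 ρ γ ℓ) (excessWord k js ℓ)
    where ℓ = lastOr0 γ ⊔ k

  record IsTerm (t : Term) : Set where
    constructor isTerm
    field
      γ-increasing : IncreasingFrom 1 (proj₁ t)
      γ-length : length ρ ≡ length (proj₁ t)
      js-length : length (proj₂ (proj₂ t)) ≡ proj₁ (proj₂ t)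

  sum-excessWord-bracketC : ∀ k js ℓ → k ≤ ℓ → length js ≡ k → sum (excessWord k js ℓ) ≡ bracketC (k , js)
  sum-excessWord-bracketC zero js ℓ _ _ = sum-zeros ℓ
  sum-excessWord-bracketC (suc k) js ℓ k≤ℓ len = sum-excessWord k js ℓ k≤ℓ len

  lastOr0-excessWord-positive : ∀ k js → 1 ≤ k → length js ≡ k → 1 ≤ lastOr0 (excessWord k js k)
  lastOr0-excessWord-positive (suc k) js _ len = subst (1 ≤_) (sym (lastOr0-excessWord k js len)) (s≤s z≤n)

  module FromTerm {γ k js} (t-isTerm : IsTerm (γ , k , js)) where

    open IsTerm t-isTerm

    ℓ : ℕ
    ℓ = lastOr0 γ ⊔ k

    k≤ℓ : k ≤ ℓ
    k≤ℓ = m≤n⊔m (lastOr0 γ) k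

    placement : Placement 1 ρ γ ℓ
    placement = record
      { increasing = γ-increasing
      ; bounded = All.map (λ x≤last → s≤s (≤-trans x≤last (m≤m⊔n (lastOr0 γ) k))) (IncreasingFrom-≤-last γ-increasing)
      ; length≡ = γ-length
      ; positive = ρ-positive }

    rw : List ℕ
    rw = scatter 1 ρ γ ℓ

    ew : List ℕ
    ew = excessWord k js ℓ

    λ′ : List ℕ
    λ′ = fromTerm (γ , k , js)

    rw-< : All (_< s) rw
    rw-< = scatter-< 0<s 1 ρ γ ℓ ρ-<

    length-rw : length rw ≡ ℓ
    length-rw = length-scatter 1 ρ γ ℓ

    length-words : length rw ≡ length ew
    length-words = trans length-rw (sym (length-excessWord k js ℓ k≤ℓ))

    positions-rw : nonzeroPositions 1 rw ≡ γ
    positions-rw = proj₁ (scatter-inverse placement)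

    nonzeros-rw : nonzeros rw ≡ ρ
    nonzeros-rw = proj₂ (scatter-inverse placement)

    residues-λ′ : residues λ′ ≡ rw
    residues-λ′ = residues-fromWords rw ew rw-< length-words

    excesses-λ′ : excesses λ′ ≡ ew
    excesses-λ′ = excesses-fromWords rw ew rw-< length-words

    -- The last row is positive: either the last residue is ρ_m ≥ 1 (ℓ = γ_m),
    -- or the last excess is positive (ℓ = k > γ_m).
    last-row-positive : 1 ≤ s * lastOr0 ew + lastOr0 rw
    last-row-positive with k ≤? lastOr0 γ
    ... | yes k≤last = ≤-trans (subst (1 ≤_) (sym last-rw) (lastOr0-positive ρ-positive ρ-nonempty)) (m≤n+m _ _)
      where
      last-rw : lastOr0 rw ≡ lastOr0 ρ
      last-rw = lastOr0-scatter placement (subst (1 ≤_) γ-length ρ-nonempty) (cong suc (sym (m≥n⇒m⊔n≡m k≤last)))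
    ... | no k≰last = ≤-trans (≤-trans 1≤last-ew (m≤n*m _ s)) (m≤m+n _ _)
      where
      ℓ≡k : ℓ ≡ k
      ℓ≡k = m≤n⇒m⊔n≡n (<⇒≤ (≰⇒> k≰last))
      1≤last-ew : 1 ≤ lastOr0 ew
      1≤last-ew = subst (λ c → 1 ≤ lastOr0 (excessWord k js c)) (sym ℓ≡k)
        (lastOr0-excessWord-positive k js (≤-trans (s≤s z≤n) (≰⇒> k≰last)) js-length)

    fromTerm-isPartition : IsPartition λ′
    fromTerm-isPartition = fromWords-isPartition rw ew length-words (subst (1 ≤_) (sym (lastOr0-fromWords rw ew length-words)) last-row-positive)

    sum-fromTerm : sum λ′ ≡ termQ (γ , k , js)
    sum-fromTerm = begin
      sum λ′                                                    ≡⟨ sum-fromWords rw ew rw-< length-words ⟩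
      s * weightedSum 1 ew + (sum rw + s * ascentIndexSum 1 rw) ≡⟨ cong₂ (λ w x → s * w + x) (weightedSum-excessWord k js ℓ k≤ℓ js-length)
                                                                     (cong₂ (λ x y → x + s * y) sum-rw (ascentIndexSum-scatter placement)) ⟩
      s * (k + weightedSum 1 js) + (sum ρ + s * dExp ρ γ)       ≡⟨ rotate (s * (k + weightedSum 1 js)) (sum ρ) (s * dExp ρ γ) ⟩
      sum ρ + (s * dExp ρ γ + s * (k + weightedSum 1 js))       ∎
      where
      sum-rw : sum rw ≡ sum ρ
      sum-rw = trans (sym (sum-nonzeros rw)) (cong sum nonzeros-rw)
      rotate : ∀ x y z → x + (y + z) ≡ y + (z + x)
      rotate = solve-∀

    rS-fromTerm : rS s λ′ ≡ termR (γ , k , js)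
    rS-fromTerm = begin
      rS s λ′                                                 ≡⟨ rS-residues λ′ ⟩
      countZeros (residues λ′)                                ≡⟨ cong countZeros residues-λ′ ⟩
      countZeros rw                                           ≡⟨ m+n∸n≡m (countZeros rw) (length (nonzeros rw)) ⟨
      countZeros rw + length (nonzeros rw) ∸ length (nonzeros rw) ≡⟨ cong₂ _∸_ (trans (countZeros+length-nonzeros rw) length-rw) (cong length nonzeros-rw) ⟩
      ℓ ∸ length ρ                                            ∎

    cS-fromTerm : cS s λ′ ≡ termC (γ , k , js)
    cS-fromTerm = trans (cS-excesses fromTerm-isPartition) (trans (cong sum excesses-λ′) (sum-excessWord-bracketC k js ℓ k≤ℓ js-length))

    remS-fromTerm : remS s λ′ ≡ ρ
    remS-fromTerm = trans (remS-residues λ′) (trans (cong nonzeros residues-λ′) nonzeros-rw)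

    toTerm-fromTerm : toTerm λ′ ≡ (γ , k , js)
    toTerm-fromTerm = cong₂ _,_ (trans (cong (nonzeroPositions 1) residues-λ′) positions-rw)
                                (trans (cong splitExcess excesses-λ′) (splitExcess-excessWord k js ℓ k≤ℓ js-length))

  remS≡ρ⇒nonempty : ∀ xs → remS s xs ≡ ρ → 1 ≤ length xs
  remS≡ρ⇒nonempty [] remS≡ρ = contradiction (subst (λ l → 1 ≤ length l) (sym remS≡ρ) ρ-nonempty) λ ()
  remS≡ρ⇒nonempty (_ ∷ _) _ = s≤s z≤n

  module ToTerm {xs} (xs-partition : IsPartition xs) (remS≡ρ : remS s xs ≡ ρ) where

    rw : List ℕ
    rw = residues xs

    ew : List ℕ
    ew = excesses xs

    γ : List ℕ
    γ = nonzeroPositions 1 rw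

    k : ℕ
    k = proj₁ (splitExcess ew)

    js : List ℕ
    js = proj₂ (splitExcess ew)

    nonzeros-rw : nonzeros rw ≡ ρ
    nonzeros-rw = trans (sym (remS-residues xs)) remS≡ρ

    toTerm-isTerm : IsTerm (toTerm xs)
    toTerm-isTerm = isTerm (nonzeroPositions-increasing 1 rw)
      (trans (cong length (sym nonzeros-rw)) (sym (length-nonzeroPositions 1 rw))) (length-splitExcess ew)

    length-rw : length rw ≡ length xs
    length-rw = length-map (_% s) xs

    length-ew : length ew ≡ length xs
    length-ew = length-excesses xs

    fromWords-words : fromWords rw ew ≡ xs
    fromWords-words = fromWords-residues-excesses xs-partition

    last-row-positive : 1 ≤ s * lastOr0 ew + lastOr0 rw
    last-row-positive = subst (1 ≤_) (trans (cong lastOr0 (sym fromWords-words)) (lastOr0-fromWords rw ew (trans length-rw (sym length-ew))))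
      (IsPartition-last xs-partition (remS≡ρ⇒nonempty xs remS≡ρ))

    ℓ≡length : lastOr0 γ ⊔ k ≡ length xs
    ℓ≡length with lastOr0 rw ≟ 0
    ... | no last-rw≢0 = trans (m≥n⇒m⊔n≡m k≤last) last-γ
      where
      last-γ : lastOr0 γ ≡ length xs
      last-γ = trans (suc-injective (lastOr0-nonzeroPositions 1 rw (n≢0⇒n>0 last-rw≢0))) length-rw
      k≤last : k ≤ lastOr0 γ
      k≤last = subst (k ≤_) (sym (trans last-γ (sym length-ew))) (splitExcess-≤ ew)
    ... | yes last-rw≡0 = trans (m≤n⇒m⊔n≡n last≤k) k≡length
      where
      k≡length : k ≡ length xs
      k≡length = trans (splitExcess-last ew 1≤last-ew) length-ew
        where
        1≤last-ew : 1 ≤ lastOr0 ew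
        1≤last-ew = n≢0⇒n>0 λ last-ew≡0 → contradiction
          (subst (1 ≤_) (trans (cong₂ (λ e r → s * e + r) last-ew≡0 last-rw≡0) (trans (+-identityʳ _) (*-zeroʳ s))) last-row-positive) λ ()
      last≤k : lastOr0 γ ≤ k
      last≤k = subst (lastOr0 γ ≤_) (trans length-rw (sym k≡length))
        (lastOr0-≤ (All.map s≤s⁻¹ (nonzeroPositions-< 1 rw)))

    fromTerm-toTerm : fromTerm (toTerm xs) ≡ xs
    fromTerm-toTerm = begin
      fromWords (scatter 1 ρ γ (lastOr0 γ ⊔ k)) (excessWord k js (lastOr0 γ ⊔ k))
        ≡⟨ cong (λ ℓ → fromWords (scatter 1 ρ γ ℓ) (excessWord k js ℓ)) ℓ≡length ⟩
      fromWords (scatter 1 ρ γ (length xs)) (excessWord k js (length xs))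
        ≡⟨ cong₂ fromWords (trans (cong₂ (λ ρ′ c → scatter 1 ρ′ γ c) (sym nonzeros-rw) (sym length-rw)) (scatter-nonzeros 1 rw))
                           (trans (cong (excessWord k js) (sym length-ew)) (excessWord-splitExcess ew)) ⟩
      fromWords rw ew
        ≡⟨ fromWords-words ⟩
      xs ∎

  _≟ᵦ_ : DecidableEquality Bracket
  _≟ᵦ_ = Product.≡-dec _≟_ _≟ₗ_

  _≟ₜ_ : DecidableEquality Term
  _≟ₜ_ = Product.≡-dec _≟ₗ_ _≟ᵦ_

  ∈-brackets⁻ : ∀ N b {t} → t ∈ brackets N b → length (proj₂ t) ≡ proj₁ t
  ∈-brackets⁻ N b (here refl) = refl
  ∈-brackets⁻ N b (there t∈) with ∈-concatMap-map⁻ _,_ (λ k → boundedVectors (range 1 k) (b ∸ 1)) (range 1 N) t∈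
  ... | k , js , _ , js∈ , refl = trans (length-∈-boundedVectors (range 1 k) (b ∸ 1) js∈) (length-range 1 k)

  ∈-terms⁻ : ∀ n a b {t} → t ∈ terms n a b → IsTerm t
  ∈-terms⁻ n a b t∈ with ∈-concatMap-map⁻ _,_ (λ γ → brackets (n ∸ sum ρ ∸ s * dExp ρ γ) b) (incSeqs m 1 (n ∸ sum ρ + m)) t∈
  ... | γ , br , γ∈ , br∈ , refl =
    let (increasing , _ , length≡) = ∈-incSeqs⁻ m 1 (n ∸ sum ρ + m) γ∈
    in isTerm increasing (sym length≡) (∈-brackets⁻ (n ∸ sum ρ ∸ s * dExp ρ γ) b br∈)

  mult-brackets : ∀ N b {k js} → length js ≡ k → bracketQ (k , js) ≤ N → bracketC (k , js) ≡ b →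
    mult _≟ᵦ_ (k , js) (brackets N b) ≡ 1
  mult-brackets N b {zero} {[]} _ _ _ = cong suc (mult-∉ _≟ᵦ_ λ t∈ →
    let (k , _ , k∈ , _ , t≡) = ∈-concatMap-map⁻ _,_ (λ k → boundedVectors (range 1 k) (b ∸ 1)) (range 1 N) t∈
    in <⇒≢ (proj₁ (∈-range⁻ 1 N k∈)) (proj₁ (Product.,-injective t≡)))
  mult-brackets N b {suc k} {js} length≡ q≤N refl = begin
    mult _≟ᵦ_ (suc k , js) (brackets N b)
      ≡⟨ cong (_+ mult _≟ᵦ_ (suc k , js) (concatMap (λ k → map (k ,_) (boundedVectors (range 1 k) (b ∸ 1))) (range 1 N))) (𝟙-no ((0 , []) ≟ᵦ (suc k , js)) (λ ())) ⟩
    mult _≟ᵦ_ (suc k , js) (concatMap (λ k → map (k ,_) (boundedVectors (range 1 k) (b ∸ 1))) (range 1 N))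
      ≡⟨ mult-concatMap _≟_ _≟ₗ_ _≟ᵦ_ _,_ Product.,-injective (λ k → boundedVectors (range 1 k) (b ∸ 1)) (range 1 N) (suc k) js ⟩
    mult _≟_ (suc k) (range 1 N) * mult _≟ₗ_ js (boundedVectors (range 1 (suc k)) b′)
      ≡⟨ cong₂ _*_ (mult-range 1 N (s≤s z≤n) k≤N) (mult-boundedVectors (range 1 (suc k)) b′ (trans length≡ (sym (length-range 1 (suc k)))) ≤-refl) ⟩
    1 ∎
    where
    b′ : ℕ
    b′ = suc (sum js) ∸ 1
    k≤N : suc k ≤ N
    k≤N = ≤-trans (≤-trans (m≤m+n (suc k) _) (m≤n*m _ s)) q≤N

  mult-terms : ∀ n a b {γ k js} → IsTerm (γ , k , js) → termQ (γ , k , js) ≡ n → termC (γ , k , js) ≡ b →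
    mult _≟ₜ_ (γ , k , js) (terms n a b) ≡ 1
  mult-terms n a b {γ} {k} {js} (isTerm increasing γ-length js-length) q≡n c≡b = begin
    mult _≟ₜ_ (γ , k , js) (terms n a b)
      ≡⟨ mult-concatMap _≟ₗ_ _≟ᵦ_ _≟ₜ_ _,_ Product.,-injective (λ γ → brackets (N ∸ s * dExp ρ γ) b) (incSeqs m 1 (N + m)) γ (k , js) ⟩
    mult _≟ₗ_ γ (incSeqs m 1 (N + m)) * mult _≟ᵦ_ (k , js) (brackets (N ∸ s * dExp ρ γ) b)
      ≡⟨ cong₂ _*_ (mult-incSeqs m 1 (N + m) increasing γ≤ (sym γ-length))
                   (mult-brackets _ b js-length (≤-reflexive (sym N′≡)) c≡b) ⟩
    1 ∎
    where
    N : ℕ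
    N = n ∸ sum ρ
    N≡ : N ≡ s * dExp ρ γ + bracketQ (k , js)
    N≡ = trans (cong (_∸ sum ρ) (sym q≡n)) (m+n∸m≡n (sum ρ) _)
    N′≡ : N ∸ s * dExp ρ γ ≡ bracketQ (k , js)
    N′≡ = trans (cong (_∸ s * dExp ρ γ) N≡) (m+n∸m≡n (s * dExp ρ γ) _)
    dExp≤N : dExp ρ γ ≤ N
    dExp≤N = subst (dExp ρ γ ≤_) (sym N≡) (≤-trans (m≤n*m (dExp ρ γ) s) (m≤m+n _ _))
    γ≤ : All (_≤ N + m) γ
    γ≤ = All.map (λ x≤last → ≤-trans x≤last (≤-trans (lastOr0-≤-dExp {ρ} increasing γ-length) (+-monoˡ-≤ m dExp≤N)))
                 (IncreasingFrom-≤-last increasing)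

  module _ (n a b : ℕ) where

    lhsWeight : List ℕ → ℕ
    lhsWeight x = 𝟙 (does (listEqᵇ (remS s x) ρ Bool.≟ true)) * mono n (rS s x) (cS s x) n a b

    rhsWeight : Term → ℕ
    rhsWeight t = mono (termQ t) (termR t) (termC t) n a b

    private
      mono-at : ∀ {q r c} → n ≡ q → a ≡ r → b ≡ c → mono q r c n a b ≡ 1
      mono-at refl refl refl = mono-diag n a b

      lhsWeight-at : ∀ {x} → remS s x ≡ ρ → a ≡ rS s x → b ≡ cS s x → lhsWeight x ≡ 1
      lhsWeight-at {x} refl a≡ b≡ =
        cong₂ _*_ (𝟙-yes (listEqᵇ (remS s x) (remS s x) Bool.≟ true) (dec-true (≡-dec _≟_ (remS s x) (remS s x)) refl))
                  (mono-at refl a≡ b≡)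

      lhsWeight-support : ∀ {x} → lhsWeight x ≢ 0 → remS s x ≡ ρ × a ≡ rS s x × b ≡ cS s x
      lhsWeight-support {x} w≢0 =
        let (indicator≢0 , mono≢0′) = *≢0⇒≢0 {𝟙 (does (listEqᵇ (remS s x) ρ Bool.≟ true))} w≢0
            listEq = 𝟙≢0⇒ (listEqᵇ (remS s x) ρ Bool.≟ true) indicator≢0
            (_ , a≡ , b≡) = mono≢0 {n} {rS s x} {cS s x} {n} mono≢0′
        in does≡true⇒ (≡-dec _≟_ (remS s x) ρ) listEq , a≡ , b≡

    toTerm-onSupport : ∀ {x} → x ∈ partitionsOf n → lhsWeight x ≢ 0 →
      mult _≟ₜ_ (toTerm x) (terms n a b) ≡ 1 × rhsWeight (toTerm x) ≡ lhsWeight x × fromTerm (toTerm x) ≡ x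
    toTerm-onSupport {x} x∈ w≢0 =
      mult-terms n a b toTerm-isTerm q≡n c≡b ,
      trans (mono-at (sym q≡n) (trans a≡ (sym r≡)) (sym c≡b)) (sym (lhsWeight-at {x} remS≡ρ a≡ b≡)) ,
      fromTerm-toTerm
      where
      x-partition : IsPartition x
      x-partition = proj₁ (∈-parts⁻ n n n x∈)
      sum≡n : sum x ≡ n
      sum≡n = proj₁ (proj₂ (∈-parts⁻ n n n x∈))
      remS≡ρ : remS s x ≡ ρ
      remS≡ρ = proj₁ (lhsWeight-support {x} w≢0)
      a≡ : a ≡ rS s x
      a≡ = proj₁ (proj₂ (lhsWeight-support {x} w≢0))
      b≡ : b ≡ cS s x
      b≡ = proj₂ (proj₂ (lhsWeight-support {x} w≢0))
      open ToTerm {x} x-partition remS≡ρ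
      module F = FromTerm toTerm-isTerm
      q≡n : termQ (toTerm x) ≡ n
      q≡n = trans (sym F.sum-fromTerm) (trans (cong sum fromTerm-toTerm) sum≡n)
      r≡ : termR (toTerm x) ≡ rS s x
      r≡ = trans (sym F.rS-fromTerm) (cong (rS s) fromTerm-toTerm)
      c≡b : termC (toTerm x) ≡ b
      c≡b = trans (sym F.cS-fromTerm) (trans (cong (cS s) fromTerm-toTerm) (sym b≡))

    fromTerm-onSupport : ∀ {t} → t ∈ terms n a b → rhsWeight t ≢ 0 →
      mult _≟ₗ_ (fromTerm t) (partitionsOf n) ≡ 1 × lhsWeight (fromTerm t) ≡ rhsWeight t × toTerm (fromTerm t) ≡ t
    fromTerm-onSupport {γ , k , js} t∈ w≢0 =
      mult-parts n n n fromTerm-isPartition sum≡n (subst (headOr0 λ′ ≤_) sum≡n (headOr0-≤-sum λ′)) ≤-refl ,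
      trans (lhsWeight-at {λ′} remS-fromTerm (trans a≡ (sym rS-fromTerm)) (trans b≡ (sym cS-fromTerm)))
            (sym (mono-at n≡ a≡ b≡)) ,
      toTerm-fromTerm
      where
      open FromTerm (∈-terms⁻ n a b t∈)
      support : n ≡ termQ (γ , k , js) × a ≡ termR (γ , k , js) × b ≡ termC (γ , k , js)
      support = mono≢0 w≢0
      n≡ : n ≡ termQ (γ , k , js)
      n≡ = proj₁ support
      a≡ : a ≡ termR (γ , k , js)
      a≡ = proj₁ (proj₂ support)
      b≡ : b ≡ termC (γ , k , js)
      b≡ = proj₂ (proj₂ support)
      sum≡n : sum λ′ ≡ n
      sum≡n = trans sum-fromTerm (sym n≡)

    LHS≡RHS : LHS s ρ n a b ≡ RHS s ρ n a b
    LHS≡RHS = begin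
      LHS s ρ n a b                     ≡⟨ Σ-filter (λ x → listEqᵇ (remS s x) ρ Bool.≟ true) (partitionsOf n) _ ⟩
      Σ[∈] (partitionsOf n) lhsWeight   ≡⟨ Σ-bijection _≟ₗ_ _≟ₜ_ (partitionsOf n) (terms n a b) lhsWeight rhsWeight
                                             toTerm fromTerm toTerm-onSupport fromTerm-onSupport ⟩
      Σ[∈] (terms n a b) rhsWeight      ≡⟨ coefficient RHS-monomialSum n a b ⟨
      RHS s ρ n a b                     ∎

lemma4p1 : (s : ℕ) .{{_ : NonZero s}} (ρ : List ℕ) →
           1 ≤ length ρ →
           All (λ r → 1 ≤ r × r ≤ s ∸ 1) ρ →
           (n a b : ℕ) → LHS s ρ n a b ≡ RHS s ρ n a b
lemma4p1 s ρ ρ-nonempty ρ-residues = Bijection.LHS≡RHS s ρ ρ-nonempty ρ-residues
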